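{- Let $A$ be an $r\times r$ symmetrisable generalised Cartan matrix and $B=B_A$. For every arithmetic $\mathbf{Y}$-frieze pattern $k$ associated to $A$ there exists a unique ring homomorphism $h:\mathcal{A}^\flat(\mathbb{Y}_B)\to\mathbb{Z}$ taking positive integer values on all $y(i,m)$ (a frieze of $\mathcal{A}^\flat(\mathbb{Y}_B)$) such that $k(i,m)=h(y(i,m))$ for all $(i,m)\in[1,r]\times\mathbb{Z}$.
   Context: A symmetrisable generalised Cartan matrix is an integer matrix $A=(a_{i,j})$ with $a_{i,i}=2$, $a_{i,j}\le0$ for $i\ne j$, $a_{i,j}=0$ iff $a_{j,i}=0$, and $DA$ symmetric for some positive diagonal $D$. An arithmetic $\mathbf{Y}$-frieze pattern is a map $k:[1,r]\times\mathbb{Z}\to\mathbb{Z}_{>0}$ with $k(i,m)k(i,m+1)=\prod_{j>i}(1+k(j,m))^{ -a_{j,i}}\prod_{j<i}(1+k(j,m+1))^{ -a_{j,i}}$ for all $(i,m)$. $B_A$ has entries $a_{i,j}$ for $i<j$, $-a_{i,j}$ for $i>j$, $0$ on the diagonal. Matrix mutation: $\mu_k(B)=(b'_{i,j})$, $b'_{i,j}=-b_{i,j}$ if $k\in\{i,j\}$, else $b_{i,j}+[b_{i,k}]_+[b_{k,j}]_+-[-b_{i,k}]_+[-b_{k,j}]_+$. Let $\mathbb{T}_r$ be the $r$-regular tree with edges at each vertex labelled bijectively by $[1,r]$, root $t_0$, $B_{t_0}=B$, $B_{t'}=\mu_k(B_t)$ along edges labelled $k$. The $\mathbf{Y}$-pattern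 $\mathbb{Y}_B$ assigns to each $t$ a tuple $\mathbf{y}_t=(y_{t;1},\dots,y_{t;r})$ of free generators of a rational function field over $\mathbb{Q}$ such that along an edge labelled $k$: $y_{t';k}=y_{t;k}^{ -1}$ and $y_{t';j}=y_{t;j}y_{t;k}^{[b_{k,j}]_+}(1+y_{t;k})^{ -b_{k,j}}$ for $j\ne k$, $(b_{i,j})=B_t$. Let $\mathcal{U}(\mathbb{Y}_B)=\bigcap_t\mathbb{Z}[\mathbf{y}_t^{\pm1}]$. Define vertices $t(i,m)$ by $t(1,0)=t_0$, $t(i,m)$—$t(i+1,m)$ joined by the edge labelled $i$ ($i<r$), $t(r,m)$—$t(1,m+1)$ by the edge labelled $r$; set $y(i,m)=y_{t(i,m);i}$ (these lie in $\mathcal{U}(\mathbb{Y}_B)$). The $\mathbf{Y}$-belt algebra $\mathcal{A}^\flat(\mathbb{Y}_B)$ is the subring of $\mathcal{U}(\mathbb{Y}_B)$ generated by all $y(i,m)$. -}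

module Defs where

open import Data.Nat as ℕ using (ℕ; zero; suc; _<ᵇ_)
open import Data.Integer as ℤ using (ℤ; +_; -[1+_]; 0ℤ; 1ℤ; ∣_∣)
open import Data.Fin using (Fin; zero; suc; toℕ)
open import Data.List using (List; []; _∷_; map; foldl; allFin; concat; replicate; take; reverse; _++_)
open import Data.List.Relation.Unary.All using (All)
open import Data.Product using (Σ; _×_; _,_; proj₁)
open import Data.Bool using (if_then_else_)
open import Relation.Binary.PropositionalEquality using (_≡_)
open import Relation.Nullary using (¬_)

Mat : ℕ → Set
Mat r = Fin r → Fin r → ℤ

record IsSymGCM {r : ℕ} (A : Mat r) : Set where
  field
    diag    : ∀ i → A i i ≡ + 2
    offdiag : ∀ i j → ¬ (i ≡ j) → A i j ℤ.≤ 0ℤ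
    zeroSym : ∀ i j → A i j ≡ 0ℤ → A j i ≡ 0ℤ
    d       : Fin r → ℕ
    d-pos   : ∀ i → 0 ℕ.< d i
    DA-sym  : ∀ i j → (+ d i) ℤ.* A i j ≡ (+ d j) ℤ.* A j i

prodFin : ∀ {r} → (Fin r → ℕ) → ℕ
prodFin {zero}  f = 1
prodFin {suc r} f = f zero ℕ.* prodFin (λ j → f (suc j))

-- arithmetic Y-frieze pattern associated to A
-- (exponent -a_{j,i} for j ≠ i is written ∣ a_{j,i} ∣, equal since a_{j,i} ≤ 0)
YFactor : ∀ {r} → Mat r → (Fin r → ℤ → ℕ) → Fin r → ℤ → Fin r → ℕ
YFactor A k i m j =
  if toℕ i <ᵇ toℕ j then (1 ℕ.+ k j m) ℕ.^ ∣ A j i ∣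
  else if toℕ j <ᵇ toℕ i then (1 ℕ.+ k j (m ℤ.+ 1ℤ)) ℕ.^ ∣ A j i ∣
  else 1

record IsArithYFrieze {r : ℕ} (A : Mat r) (k : Fin r → ℤ → ℕ) : Set where
  field
    positive : ∀ i m → 0 ℕ.< k i m
    relation : ∀ i m → k i m ℕ.* k i (m ℤ.+ 1ℤ) ≡ prodFin (YFactor A k i m)

BA : ∀ {r} → Mat r → Mat r
BA A i j = if toℕ i <ᵇ toℕ j then A i j
           else if toℕ j <ᵇ toℕ i then ℤ.- A i j else 0ℤ

-- Integer polynomials in n variables (recursive/Horner representation)

Poly : ℕ → Set
Poly zero    = ℤ
Poly (suc n) = List (Poly n)

zeroP : ∀ {n} → Poly n
zeroP {zero}  = 0ℤ
zeroP {suc n} = []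

constP : ∀ {n} → ℤ → Poly n
constP {zero}  z = z
constP {suc n} z = constP z ∷ []

oneP : ∀ {n} → Poly n
oneP = constP 1ℤ

addP : ∀ {n} → Poly n → Poly n → Poly n
addP {zero}  a b = a ℤ.+ b
addP {suc n} [] q = q
addP {suc n} (a ∷ p) [] = a ∷ p
addP {suc n} (a ∷ p) (b ∷ q) = addP a b ∷ addP p q

negP : ∀ {n} → Poly n → Poly n
negP {zero}  a = ℤ.- a
negP {suc n} [] = []
negP {suc n} (a ∷ p) = negP a ∷ negP p

mutual
  scaleP : ∀ {n} → Poly n → List (Poly n) → List (Poly n)
  scaleP a [] = []
  scaleP a (b ∷ q) = mulP a b ∷ scaleP a q

  mulP : ∀ {n} → Poly n → Poly n → Poly n
  mulP {zero}  a b = a ℤ.* b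
  mulP {suc n} [] q = []
  mulP {suc n} (a ∷ p) q = addP (scaleP a q) (zeroP ∷ mulP p q)

varP : ∀ {n} → Fin n → Poly n
varP {suc n} zero    = zeroP ∷ oneP ∷ []
varP {suc n} (suc i) = varP i ∷ []

IsZeroP : ∀ {n} → Poly n → Set
IsZeroP {zero}  a = a ≡ 0ℤ
IsZeroP {suc n} p = All IsZeroP p

_≈P_ : ∀ {n} → Poly n → Poly n → Set
p ≈P q = IsZeroP (addP p (negP q))

-- Rational functions Q(y_1,…,y_r) as fractions of integer polynomials

record Frac (n : ℕ) : Set where
  constructor _/_
  field
    num : Poly n
    den : Poly n
open Frac public

_≈F_ : ∀ {n} → Frac n → Frac n → Set
(p / q) ≈F (p' / q') = mulP p q' ≈P mulP p' q

0F 1F : ∀ {n} → Frac n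
0F = zeroP / oneP
1F = oneP / oneP

constF : ∀ {n} → ℤ → Frac n
constF z = constP z / oneP

_+F_ _*F_ : ∀ {n} → Frac n → Frac n → Frac n
(p / q) +F (p' / q') = addP (mulP p q') (mulP p' q) / mulP q q'
(p / q) *F (p' / q') = mulP p p' / mulP q q'

invF : ∀ {n} → Frac n → Frac n
invF (p / q) = q / p

powF : ∀ {n} → Frac n → ℕ → Frac n
powF f zero    = 1F
powF f (suc e) = f *F powF f e

powZF : ∀ {n} → Frac n → ℤ → Frac n
powZF f (+ e)    = powF f e
powZF f -[1+ e ] = invF (powF f (suc e))

[_]₊ : ℤ → ℤ
[ + n ]₊    = + n
[ -[1+ n ] ]₊ = 0ℤ

_≟F_ : ∀ {r} → Fin r → Fin r → Data.Bool.Bool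
i ≟F j = toℕ i ℕ.≡ᵇ toℕ j

μB : ∀ {r} → Fin r → Mat r → Mat r
μB k B i j =
  if (i ≟F k) Data.Bool.∨ (j ≟F k) then ℤ.- B i j
  else B i j ℤ.+ [ B i k ]₊ ℤ.* [ B k j ]₊ ℤ.- [ ℤ.- B i k ]₊ ℤ.* [ ℤ.- B k j ]₊

YSeed : ℕ → Set
YSeed r = Mat r × (Fin r → Frac r)

μY : ∀ {r} → Fin r → YSeed r → YSeed r
μY k (B , y) = μB k B , y'
  where
  y' : _ → Frac _
  y' j = if j ≟F k then invF (y k)
         else y j *F (powZF (y k) [ B k j ]₊ *F powZF (1F +F y k) (ℤ.- B k j))

-- initial seed at the root t₀: (B, (y_1,…,y_r)) with y_i the free generators
rootSeed : ∀ {r} → Mat r → YSeed r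
rootSeed B = B , (λ j → varP j / oneP)

-- seed at the vertex of 𝕋_r reached from t₀ by the path with edge labels w
seedAt : ∀ {r} → Mat r → List (Fin r) → YSeed r
seedAt B w = foldl (λ s k → μY k s) (rootSeed B) w

-- path from t₀ to t(i,m)
pathTo : ∀ {r} → Fin r → ℤ → List (Fin r)
pathTo {r} i (+ m) = concat (replicate m (allFin r)) ++ take (toℕ i) (allFin r)
pathTo {r} i -[1+ n ] =
  concat (replicate n (reverse (allFin r))) ++ take (r ℕ.∸ toℕ i) (reverse (allFin r))

-- y(i,m) = y_{t(i,m);i}
yBelt : ∀ {r} → Mat r → Fin r → ℤ → Frac r
yBelt B i m = proj₂' (seedAt B (pathTo i m)) i
  where
  proj₂' : ∀ {r} → YSeed r → Fin r → Frac r
  proj₂' (_ , y) = y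

-- The Y-belt algebra: subring of Q(y) generated by all y(i,m)

data Expr (r : ℕ) : Set where
  gen  : Fin r → ℤ → Expr r
  cst  : ℤ → Expr r
  _⊕_  : Expr r → Expr r → Expr r
  _⊗_  : Expr r → Expr r → Expr r

evalE : ∀ {r} → Mat r → Expr r → Frac r
evalE B (gen i m) = yBelt B i m
evalE B (cst z)   = constF z
evalE B (e ⊕ f)   = evalE B e +F evalE B f
evalE B (e ⊗ f)   = evalE B e *F evalE B f

-- elements of 𝒜♭(𝕐_B): genuine rational functions (nonzero denominator)
-- that are integer polynomial expressions in the y(i,m)
record Belt {r : ℕ} (B : Mat r) : Set where
  constructor belt
  field
    val     : Frac r
    den≢0   : ¬ IsZeroP (den val)
    expr    : Expr r
    expr≈   : evalE B expr ≈F val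
open Belt public

-- ring homomorphisms 𝒜♭(𝕐_B) → ℤ (well defined on equal rational functions)
record IsRingHom {r : ℕ} {B : Mat r} (h : Belt B → ℤ) : Set where
  field
    resp : ∀ x y → val x ≈F val y → h x ≡ h y
    one  : ∀ x → val x ≈F 1F → h x ≡ 1ℤ
    add  : ∀ x y z → (val x +F val y) ≈F val z → h z ≡ h x ℤ.+ h y
    mul  : ∀ x y z → (val x *F val y) ≈F val z → h z ≡ h x ℤ.* h y

Matches : ∀ {r} {B : Mat r} → (Belt B → ℤ) → (Fin r → ℤ → ℕ) → Set
Matches {r} {B} h k = ∀ i m (x : Belt B) → val x ≈F yBelt B i m → h x ≡ + k i m

-- The frieze k singles out a point c of (ℚ_{>0})^r, the value of the initial Y-variables.
-- Evaluating the Y-seed mutations along the belt t(1,0) — t(2,0) — ⋯ at c keeps all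
-- numerators and denominators positive and gives explicit values: after the mutations
-- at 1, …, s of round m they are K(j,m)⁻¹ ∏_{j<l≤s}(1+K(l,m))^{|a_lj|} for j ≤ s and
-- K(j,m) ∏_{s<l<j}(1+K(l,m))^{-|a_lj|} for j > s, with K = k as rationals. The frieze
-- relation is exactly what glues the end of round m to the start of round m+1, so every
-- y(i,m) evaluates to k(i,m). An element of the belt algebra is an integer polynomial
-- expression in the y(i,m), whose value at c is therefore the integer obtained by
-- substituting k; this value does not depend on the expression, and is additive and
-- multiplicative, because equality of rational functions can be tested at integer points
-- (two nonzero integer polynomials have a common integer non-root). Conversely a ring
-- homomorphism is the identity on ℤ and is prescribed on the generators, hence unique.

module Submission where

open import Defs
open import Algebra.Bundles using (CommutativeRing; AbelianGroup)
open import Algebra.Morphism.Structures using (module RingMorphisms)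
open import Algebra.Morphism.Construct.Identity using (isRingHomomorphism)
open import Data.Bool using (true; false; if_then_else_)
open import Data.Bool.Properties using (∨-zeroʳ)
open import Data.Fin as Fin using (Fin; zero; suc; toℕ; punchIn)
open import Data.Fin.Properties using (toℕ-injective; toℕ<n; punchInᵢ≢i)
open import Data.Integer as ℤ using (ℤ; +_; -[1+_]; 0ℤ; 1ℤ; ∣_∣)
import Data.Integer.Properties as ℤP
open import Data.Integer.Tactic.RingSolver using (solve-∀)
open import Data.List using (List; []; _∷_; _++_; map; foldl; take; reverse; concat; replicate; tabulate; allFin)
open import Data.List.Properties using (foldl-++; unfold-reverse)
open import Data.List.Membership.Propositional using (_∈_; find)
open import Data.List.Relation.Unary.All as All using (All; []; _∷_; all?)
open import Data.List.Relation.Unary.All.Properties using (¬All⇒Any¬; map⁻)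
open import Data.Maybe using (nothing)
open import Data.Nat as ℕ using (ℕ; zero; suc; z≤n; s≤s)
import Data.Nat.Coprimality as Coprimality
open import Data.Nat.ListAction using (sum)
import Data.Nat.Properties as ℕP
open import Data.Product using (Σ; ∃-syntax; _×_; _,_; proj₁; proj₂; uncurry)
open import Data.Rational as ℚ using (ℚ; mkℚ; 0ℚ; 1ℚ)
import Data.Rational.Properties as ℚP
open import Data.Rational.Solver using (module +-*-Solver)
open import Data.Sum using (_⊎_; inj₁; inj₂)
import Data.Vec.Functional as Vector
open import Function using (id; _∘_; case_of_)
open import Relation.Nullary using (¬_; Dec; does; yes; no; contradiction; _×-dec_)
open import Relation.Nullary.Decidable using (decidable-stable; dec-true; dec-false; map′)
open import Relation.Binary.PropositionalEquality
  using (_≡_; _≢_; refl; sym; trans; cong; cong₂; subst; subst₂; module ≡-Reasoning)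
import Tactic.RingSolver.Core.AlmostCommutativeRing as ACR
open import Algebra.Definitions.RawSemiring ℚ.+-*-rawSemiring using (_^_)
open import Algebra.Properties.CommutativeSemiring.Exp
  (CommutativeRing.commutativeSemiring ℚP.+-*-commutativeRing) using (^-distrib-*)
open import Algebra.Properties.CommutativeMonoid.Sum ℚP.*-1-commutativeMonoid using ()
  renaming (sum to product; sum-cong-≗ to product-cong; sum-remove to product-remove;
            ∑-distrib-+ to product-distrib-*)
open import Algebra.Properties.Group (AbelianGroup.group ℤP.+-0-abelianGroup)
  using (identityʳ-unique; inverseˡ-unique)

-- Evaluation of integer polynomials in a commutative ring

module Evaluation {c ℓ} (R : CommutativeRing c ℓ) (ι : ℤ → CommutativeRing.Carrier R)
  (ι-isRingHomomorphism : RingMorphisms.IsRingHomomorphism ℤ.+-*-rawRing (CommutativeRing.rawRing R) ι) where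

  open CommutativeRing R hiding (zero) renaming (refl to ≈-refl; sym to ≈-sym; trans to ≈-trans)
  open RingMorphisms.IsRingHomomorphism ι-isRingHomomorphism
    using (+-homo; *-homo; 0#-homo; 1#-homo; -‿homo)
  open import Tactic.RingSolver.NonReflective (ACR.fromCommutativeRing R (λ _ → nothing))
  open import Relation.Binary.Reasoning.Setoid setoid
  open import Algebra.Properties.Ring ring using (-0#≈0#; -‿distribʳ-*)
  open import Algebra.Properties.AbelianGroup +-abelianGroup using (⁻¹-∙-comm)
  open import Algebra.Properties.Group +-group using (x∙y⁻¹≈ε⇒x≈y)

  evalP : ∀ {n} → Poly n → (Fin n → Carrier) → Carrier
  evalP {zero}  a       x = ι a
  evalP {suc n} []      x = 0#
  evalP {suc n} (a ∷ p) x = evalP a (x ∘ suc) + x zero * evalP p x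

  evalP-zeroP : ∀ {n} x → evalP (zeroP {n}) x ≈ 0#
  evalP-zeroP {zero}  x = 0#-homo
  evalP-zeroP {suc n} x = ≈-refl

  evalP-constP : ∀ {n} z x → evalP (constP {n} z) x ≈ ι z
  evalP-constP {zero}  z x = ≈-refl
  evalP-constP {suc n} z x = begin
    evalP (constP z) (x ∘ suc) + x zero * 0# ≈⟨ +-cong (evalP-constP z (x ∘ suc)) (zeroʳ _) ⟩
    ι z + 0#                                ≈⟨ +-identityʳ _ ⟩
    ι z                                     ∎

  evalP-varP : ∀ {n} (i : Fin n) x → evalP (varP i) x ≈ x i
  evalP-varP {suc n} zero x = begin
    evalP zeroP (x ∘ suc) + x zero * (evalP oneP (x ∘ suc) + x zero * 0#)
      ≈⟨ +-cong (evalP-zeroP (x ∘ suc)) (*-congˡ (+-cong (≈-trans (evalP-constP 1ℤ (x ∘ suc)) 1#-homo) (zeroʳ _))) ⟩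
    0# + x zero * (1# + 0#)
      ≈⟨ +-identityˡ _ ⟩
    x zero * (1# + 0#)
      ≈⟨ *-congˡ (+-identityʳ 1#) ⟩
    x zero * 1#
      ≈⟨ *-identityʳ _ ⟩
    x zero ∎
  evalP-varP {suc n} (suc i) x = begin
    evalP (varP i) (x ∘ suc) + x zero * 0# ≈⟨ +-cong (evalP-varP i (x ∘ suc)) (zeroʳ _) ⟩
    x (suc i) + 0#                         ≈⟨ +-identityʳ _ ⟩
    x (suc i)                              ∎

  evalP-addP : ∀ {n} p q x → evalP (addP {n} p q) x ≈ evalP p x + evalP q x
  evalP-addP {zero}  p       q       x = +-homo p q
  evalP-addP {suc n} []      q       x = ≈-sym (+-identityˡ _)
  evalP-addP {suc n} (a ∷ p) []      x = ≈-sym (+-identityʳ _)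
  evalP-addP {suc n} (a ∷ p) (b ∷ q) x = begin
    evalP (addP a b) (x ∘ suc) + x zero * evalP (addP p q) x
      ≈⟨ +-cong (evalP-addP a b (x ∘ suc)) (*-congˡ (evalP-addP p q x)) ⟩
    (evalP a (x ∘ suc) + evalP b (x ∘ suc)) + x zero * (evalP p x + evalP q x)
      ≈⟨ solve 5 (λ A B X P Q → ((A ⊕ B) ⊕ X ⊗ (P ⊕ Q)) ⊜ ((A ⊕ X ⊗ P) ⊕ (B ⊕ X ⊗ Q))) ≈-refl
           (evalP a (x ∘ suc)) (evalP b (x ∘ suc)) (x zero) (evalP p x) (evalP q x) ⟩
    (evalP a (x ∘ suc) + x zero * evalP p x) + (evalP b (x ∘ suc) + x zero * evalP q x) ∎

  evalP-negP : ∀ {n} p x → evalP (negP {n} p) x ≈ - evalP p x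
  evalP-negP {zero}  p       x = -‿homo p
  evalP-negP {suc n} []      x = ≈-sym -0#≈0#
  evalP-negP {suc n} (a ∷ p) x = begin
    evalP (negP a) (x ∘ suc) + x zero * evalP (negP p) x
      ≈⟨ +-cong (evalP-negP a (x ∘ suc)) (*-congˡ (evalP-negP p x)) ⟩
    - evalP a (x ∘ suc) + x zero * - evalP p x
      ≈⟨ +-congˡ (≈-sym (-‿distribʳ-* _ _)) ⟩
    - evalP a (x ∘ suc) + - (x zero * evalP p x)
      ≈⟨ ⁻¹-∙-comm _ _ ⟩
    - (evalP a (x ∘ suc) + x zero * evalP p x) ∎

  mutual
    evalP-scaleP : ∀ {n} (a : Poly n) (q : List (Poly n)) x →
      evalP {suc n} (scaleP a q) x ≈ evalP a (x ∘ suc) * evalP {suc n} q x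
    evalP-scaleP a []      x = ≈-sym (zeroʳ _)
    evalP-scaleP a (b ∷ q) x = begin
      evalP (mulP a b) (x ∘ suc) + x zero * evalP (scaleP a q) x
        ≈⟨ +-cong (evalP-mulP a b (x ∘ suc)) (*-congˡ (evalP-scaleP a q x)) ⟩
      evalP a (x ∘ suc) * evalP b (x ∘ suc) + x zero * (evalP a (x ∘ suc) * evalP q x)
        ≈⟨ solve 4 (λ A B X Q → (A ⊗ B ⊕ X ⊗ (A ⊗ Q)) ⊜ (A ⊗ (B ⊕ X ⊗ Q))) ≈-refl
             (evalP a (x ∘ suc)) (evalP b (x ∘ suc)) (x zero) (evalP q x) ⟩
      evalP a (x ∘ suc) * (evalP b (x ∘ suc) + x zero * evalP q x) ∎

    evalP-mulP : ∀ {n} p q x → evalP (mulP {n} p q) x ≈ evalP p x * evalP q x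
    evalP-mulP {zero}  p       q x = *-homo p q
    evalP-mulP {suc n} []      q x = ≈-sym (zeroˡ _)
    evalP-mulP {suc n} (a ∷ p) q x = begin
      evalP (addP (scaleP a q) (zeroP ∷ mulP p q)) x
        ≈⟨ evalP-addP (scaleP a q) (zeroP ∷ mulP p q) x ⟩
      evalP (scaleP a q) x + (evalP zeroP (x ∘ suc) + x zero * evalP (mulP p q) x)
        ≈⟨ +-cong (evalP-scaleP a q x) (+-cong (evalP-zeroP (x ∘ suc)) (*-congˡ (evalP-mulP p q x))) ⟩
      evalP a (x ∘ suc) * evalP q x + (0# + x zero * (evalP p x * evalP q x))
        ≈⟨ +-congˡ (+-identityˡ _) ⟩
      evalP a (x ∘ suc) * evalP q x + x zero * (evalP p x * evalP q x)
        ≈⟨ solve 4 (λ A Q X P → (A ⊗ Q ⊕ X ⊗ (P ⊗ Q)) ⊜ ((A ⊕ X ⊗ P) ⊗ Q)) ≈-refl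
             (evalP a (x ∘ suc)) (evalP q x) (x zero) (evalP p x) ⟩
      (evalP a (x ∘ suc) + x zero * evalP p x) * evalP q x ∎

  evalP-num-+F : ∀ {n} (F G : Frac n) x →
    evalP (num (F +F G)) x ≈ evalP (num F) x * evalP (den G) x + evalP (num G) x * evalP (den F) x
  evalP-num-+F F G x =
    ≈-trans (evalP-addP _ _ x) (+-cong (evalP-mulP (num F) (den G) x) (evalP-mulP (num G) (den F) x))

  evalP-IsZeroP : ∀ {n} (p : Poly n) x → IsZeroP p → evalP p x ≈ 0#
  evalP-IsZeroP {zero}  p       x refl      = 0#-homo
  evalP-IsZeroP {suc n} []      x []        = ≈-refl
  evalP-IsZeroP {suc n} (a ∷ p) x (za ∷ zp) = begin
    evalP a (x ∘ suc) + x zero * evalP p x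
      ≈⟨ +-cong (evalP-IsZeroP a (x ∘ suc) za) (*-congˡ (evalP-IsZeroP p x zp)) ⟩
    0# + x zero * 0#
      ≈⟨ +-identityˡ _ ⟩
    x zero * 0#
      ≈⟨ zeroʳ _ ⟩
    0# ∎

  ≈F⇒cross : ∀ {n} (F G : Frac n) → F ≈F G → ∀ x →
    evalP (num F) x * evalP (den G) x ≈ evalP (num G) x * evalP (den F) x
  ≈F⇒cross (p / q) (p' / q') F≈G x = x∙y⁻¹≈ε⇒x≈y _ _ (begin
    evalP p x * evalP q' x + - (evalP p' x * evalP q x)
      ≈⟨ ≈-sym (+-cong (evalP-mulP p q' x) (≈-trans (evalP-negP (mulP p' q) x) (-‿cong (evalP-mulP p' q x)))) ⟩
    evalP (mulP p q') x + evalP (negP (mulP p' q)) x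
      ≈⟨ ≈-sym (evalP-addP (mulP p q') (negP (mulP p' q)) x) ⟩
    evalP (addP (mulP p q') (negP (mulP p' q))) x
      ≈⟨ evalP-IsZeroP _ x F≈G ⟩
    0# ∎)

-- ≈F compares fixed representatives, so its equivalence and congruence laws are obtained
-- by evaluation at integer points.
module IntegerPoints where

  open Evaluation ℤP.+-*-commutativeRing id (isRingHomomorphism ℤ.+-*-rawRing refl)
    renaming (evalP to evalℤ)

  IsZeroP? : ∀ {n} (p : Poly n) → Dec (IsZeroP p)
  IsZeroP? {zero}  a = a ℤ.≟ 0ℤ
  IsZeroP? {suc n} p = all? IsZeroP? p

  horner : List ℤ → ℤ → ℤ
  horner []       t = 0ℤ
  horner (c ∷ cs) t = c ℤ.+ t ℤ.* horner cs t

  horner-zero : ∀ cs t → All (_≡ 0ℤ) cs → horner cs t ≡ 0ℤ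
  horner-zero []       t []            = refl
  horner-zero (c ∷ cs) t (refl ∷ cs≡0) = begin
    0ℤ ℤ.+ t ℤ.* horner cs t ≡⟨ ℤP.+-identityˡ _ ⟩
    t ℤ.* horner cs t        ≡⟨ cong (t ℤ.*_) (horner-zero cs t cs≡0) ⟩
    t ℤ.* 0ℤ                 ≡⟨ ℤP.*-zeroʳ t ⟩
    0ℤ                       ∎
    where open ≡-Reasoning

  -- Cauchy's bound: past the sum of the absolute values of the coefficients,
  -- |c + t h| ≥ t |h| - |c| > 0 whenever h ≠ 0.
  horner-≢0 : ∀ S cs → All (λ c → ∣ c ∣ ℕ.≤ S) cs → ¬ All (_≡ 0ℤ) cs → horner cs (+ suc S) ≢ 0ℤ
  horner-≢0 S []       []               cs≢0  = contradiction [] cs≢0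
  horner-≢0 S (c ∷ cs) (∣c∣≤S ∷ ∣cs∣≤S) ccs≢0 with all? (ℤ._≟ 0ℤ) cs
  ... | yes cs≡0 = λ c+th≡0 → ccs≢0 (trans (sym c+th≡c) c+th≡0 ∷ cs≡0)
    where
    c+th≡c : horner (c ∷ cs) (+ suc S) ≡ c
    c+th≡c = trans (cong (λ h → c ℤ.+ + suc S ℤ.* h) (horner-zero cs (+ suc S) cs≡0))
                   (trans (cong (λ u → c ℤ.+ u) (ℤP.*-zeroʳ (+ suc S))) (ℤP.+-identityʳ c))
  ... | no cs≢0 = λ c+th≡0 → ℕP.<⇒≱ (s≤s ∣c∣≤S) (begin
    suc S                              ≡⟨ ℕP.*-identityʳ (suc S) ⟨
    suc S ℕ.* 1                        ≤⟨ ℕP.*-monoʳ-≤ (suc S) 1≤∣h∣ ⟩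
    suc S ℕ.* ∣ h ∣                    ≡⟨ ℤP.abs-* t h ⟨
    ∣ t ℤ.* h ∣                        ≡⟨ cong ∣_∣ (c+u-c≡u c (t ℤ.* h)) ⟨
    ∣ (c ℤ.+ t ℤ.* h) ℤ.- c ∣          ≤⟨ ℤP.∣i-j∣≤∣i∣+∣j∣ (c ℤ.+ t ℤ.* h) c ⟩
    ∣ c ℤ.+ t ℤ.* h ∣ ℕ.+ ∣ c ∣        ≡⟨ cong (λ z → ∣ z ∣ ℕ.+ ∣ c ∣) c+th≡0 ⟩
    ∣ c ∣                              ∎)
    where
    open ℕP.≤-Reasoning
    t = + suc S
    h = horner cs t
    1≤∣h∣ : 1 ℕ.≤ ∣ h ∣
    1≤∣h∣ = ℕP.n≢0⇒n>0 (horner-≢0 S cs ∣cs∣≤S cs≢0 ∘ ℤP.∣i∣≡0⇒i≡0)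
    c+u-c≡u : ∀ c u → (c ℤ.+ u) ℤ.- c ≡ u
    c+u-c≡u = solve-∀

  ∣∣≤sum : ∀ S cs → sum (map ∣_∣ cs) ℕ.≤ S → All (λ c → ∣ c ∣ ℕ.≤ S) cs
  ∣∣≤sum S []       _  = []
  ∣∣≤sum S (c ∷ cs) le =
    ℕP.m+n≤o⇒m≤o ∣ c ∣ le ∷ ∣∣≤sum S cs (ℕP.m+n≤o⇒n≤o ∣ c ∣ le)

  coefficientsAt : ∀ {n} → Poly (suc n) → (Fin n → ℤ) → List ℤ
  coefficientsAt p x = map (λ a → evalℤ a x) p

  evalℤ-horner : ∀ {n} (p : Poly (suc n)) t x → evalℤ p (t Vector.∷ x) ≡ horner (coefficientsAt p x) t
  evalℤ-horner []      t x = refl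
  evalℤ-horner (a ∷ p) t x = cong (λ h → evalℤ a x ℤ.+ t ℤ.* h) (evalℤ-horner p t x)

  nonzero-coefficient : ∀ {n} (p : Poly (suc n)) → ¬ IsZeroP p → ∃[ a ] (a ∈ p × ¬ IsZeroP a)
  nonzero-coefficient p p≢0 = find (¬All⇒Any¬ IsZeroP? p p≢0)

  nonroot-beyond-bound : ∀ {n} (p : Poly (suc n)) x S → sum (map ∣_∣ (coefficientsAt p x)) ℕ.≤ S →
    ∀ {a} → a ∈ p → evalℤ a x ≢ 0ℤ → evalℤ p (+ suc S Vector.∷ x) ≢ 0ℤ
  nonroot-beyond-bound p x S sum≤S a∈p ax≢0 px≡0 =
    horner-≢0 S (coefficientsAt p x) (∣∣≤sum S _ sum≤S)
      (λ all≡0 → ax≢0 (All.lookup (map⁻ all≡0) a∈p))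
      (trans (sym (evalℤ-horner p _ x)) px≡0)

  common-nonroot : ∀ {n} (p q : Poly n) → ¬ IsZeroP p → ¬ IsZeroP q →
    ∃[ x ] (evalℤ p x ≢ 0ℤ × evalℤ q x ≢ 0ℤ)
  common-nonroot {zero}  p q p≢0 q≢0 = (λ ()) , p≢0 , q≢0
  common-nonroot {suc n} p q p≢0 q≢0 =
    let a , a∈p , a≢0 = nonzero-coefficient p p≢0
        b , b∈q , b≢0 = nonzero-coefficient q q≢0
        x , ax≢0 , bx≢0 = common-nonroot a b a≢0 b≢0
        Sp = sum (map ∣_∣ (coefficientsAt p x))
        Sq = sum (map ∣_∣ (coefficientsAt q x))
    in (+ suc (Sp ℕ.+ Sq) Vector.∷ x)
     , nonroot-beyond-bound p x _ (ℕP.m≤m+n Sp Sq) a∈p ax≢0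
     , nonroot-beyond-bound q x _ (ℕP.m≤n+m Sq Sp) b∈q bx≢0

  vanishing⇒IsZeroP : ∀ {n} (p : Poly n) → (∀ x → evalℤ p x ≡ 0ℤ) → IsZeroP p
  vanishing⇒IsZeroP p p≡0 = decidable-stable (IsZeroP? p) λ p≢0 →
    let x , px≢0 , _ = common-nonroot p p p≢0 p≢0 in px≢0 (p≡0 x)

  *-vanishing⇒IsZeroP : ∀ {n} (p d : Poly n) → ¬ IsZeroP d →
    (∀ x → evalℤ p x ℤ.* evalℤ d x ≡ 0ℤ) → IsZeroP p
  *-vanishing⇒IsZeroP p d d≢0 pd≡0 = decidable-stable (IsZeroP? p) λ p≢0 →
    let x , px≢0 , dx≢0 = common-nonroot p d p≢0 d≢0 in
    case ℤP.i*j≡0⇒i≡0∨j≡0 (evalℤ p x) (pd≡0 x) of λ where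
      (inj₁ px≡0) → px≢0 px≡0
      (inj₂ dx≡0) → dx≢0 dx≡0

  mulP-≢0 : ∀ {n} (p q : Poly n) → ¬ IsZeroP p → ¬ IsZeroP q → ¬ IsZeroP (mulP p q)
  mulP-≢0 p q p≢0 q≢0 pq≡0 =
    let x , px≢0 , qx≢0 = common-nonroot p q p≢0 q≢0 in
    case ℤP.i*j≡0⇒i≡0∨j≡0 (evalℤ p x) (trans (sym (evalP-mulP p q x)) (evalP-IsZeroP _ x pq≡0)) of λ where
      (inj₁ px≡0) → px≢0 px≡0
      (inj₂ qx≡0) → qx≢0 qx≡0

  cross-+ : ∀ a c b d a' c' b' d' → a ℤ.* c' ≡ a' ℤ.* c → b ℤ.* d' ≡ b' ℤ.* d →
    (a ℤ.* d ℤ.+ b ℤ.* c) ℤ.* (c' ℤ.* d') ≡ (a' ℤ.* d' ℤ.+ b' ℤ.* c') ℤ.* (c ℤ.* d)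
  cross-+ a c b d a' c' b' d' ac'≡a'c bd'≡b'd = begin
    (a ℤ.* d ℤ.+ b ℤ.* c) ℤ.* (c' ℤ.* d')
      ≡⟨ expand a b c d c' d' ⟩
    (a ℤ.* c') ℤ.* (d ℤ.* d') ℤ.+ (b ℤ.* d') ℤ.* (c ℤ.* c')
      ≡⟨ cong₂ (λ u v → u ℤ.* (d ℤ.* d') ℤ.+ v ℤ.* (c ℤ.* c')) ac'≡a'c bd'≡b'd ⟩
    (a' ℤ.* c) ℤ.* (d ℤ.* d') ℤ.+ (b' ℤ.* d) ℤ.* (c ℤ.* c')
      ≡⟨ collect a' b' c d c' d' ⟩
    (a' ℤ.* d' ℤ.+ b' ℤ.* c') ℤ.* (c ℤ.* d) ∎
    where
    open ≡-Reasoning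
    expand : ∀ a b c d c' d' → (a ℤ.* d ℤ.+ b ℤ.* c) ℤ.* (c' ℤ.* d') ≡ (a ℤ.* c') ℤ.* (d ℤ.* d') ℤ.+ (b ℤ.* d') ℤ.* (c ℤ.* c')
    expand = solve-∀
    collect : ∀ a' b' c d c' d' → (a' ℤ.* c) ℤ.* (d ℤ.* d') ℤ.+ (b' ℤ.* d) ℤ.* (c ℤ.* c') ≡ (a' ℤ.* d' ℤ.+ b' ℤ.* c') ℤ.* (c ℤ.* d)
    collect = solve-∀

  cross-* : ∀ a c b d a' c' b' d' → a ℤ.* c' ≡ a' ℤ.* c → b ℤ.* d' ≡ b' ℤ.* d →
    (a ℤ.* b) ℤ.* (c' ℤ.* d') ≡ (a' ℤ.* b') ℤ.* (c ℤ.* d)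
  cross-* a c b d a' c' b' d' ac'≡a'c bd'≡b'd = begin
    (a ℤ.* b) ℤ.* (c' ℤ.* d')   ≡⟨ interchange a b c' d' ⟩
    (a ℤ.* c') ℤ.* (b ℤ.* d')   ≡⟨ cong₂ ℤ._*_ ac'≡a'c bd'≡b'd ⟩
    (a' ℤ.* c) ℤ.* (b' ℤ.* d)   ≡⟨ interchange a' c b' d ⟩
    (a' ℤ.* b') ℤ.* (c ℤ.* d)   ∎
    where
    open ≡-Reasoning
    interchange : ∀ w x y z → (w ℤ.* x) ℤ.* (y ℤ.* z) ≡ (w ℤ.* y) ℤ.* (x ℤ.* z)
    interchange = solve-∀

  module _ {n : ℕ} where

    CrossAt : Frac n → Frac n → (Fin n → ℤ) → Set
    CrossAt F G x = evalℤ (num F) x ℤ.* evalℤ (den G) x ≡ evalℤ (num G) x ℤ.* evalℤ (den F) x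

    ≈F-byEvaluation : ∀ (F G : Frac n) → (∀ x → CrossAt F G x) → F ≈F G
    ≈F-byEvaluation (p / q) (p' / q') cross = vanishing⇒IsZeroP _ λ x → begin
      evalℤ (addP (mulP p q') (negP (mulP p' q))) x
        ≡⟨ evalP-addP (mulP p q') _ x ⟩
      evalℤ (mulP p q') x ℤ.+ evalℤ (negP (mulP p' q)) x
        ≡⟨ cong₂ ℤ._+_ (evalP-mulP p q' x) (trans (evalP-negP (mulP p' q) x) (cong ℤ.-_ (evalP-mulP p' q x))) ⟩
      evalℤ p x ℤ.* evalℤ q' x ℤ.- evalℤ p' x ℤ.* evalℤ q x
        ≡⟨ cong (ℤ._- evalℤ p' x ℤ.* evalℤ q x) (cross x) ⟩
      evalℤ p' x ℤ.* evalℤ q x ℤ.- evalℤ p' x ℤ.* evalℤ q x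
        ≡⟨ ℤP.+-inverseʳ (evalℤ p' x ℤ.* evalℤ q x) ⟩
      0ℤ ∎
      where open ≡-Reasoning

    ≈F-refl : ∀ (F : Frac n) → F ≈F F
    ≈F-refl F = ≈F-byEvaluation F F λ x → refl

    ≈F-sym : ∀ (F G : Frac n) → F ≈F G → G ≈F F
    ≈F-sym F G F≈G = ≈F-byEvaluation G F λ x → sym (≈F⇒cross F G F≈G x)

    ≈F-trans : ∀ (F G H : Frac n) → ¬ IsZeroP (den G) → F ≈F G → G ≈F H → F ≈F H
    ≈F-trans F G H G≢0 F≈G G≈H = *-vanishing⇒IsZeroP _ (den G) G≢0 vanishes
      where
      rearrange : ∀ a b df dh dg → (a ℤ.* dh ℤ.- b ℤ.* df) ℤ.* dg ≡ (a ℤ.* dg) ℤ.* dh ℤ.- (b ℤ.* dg) ℤ.* df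
      rearrange = solve-∀
      cancel : ∀ g df dh → (g ℤ.* df) ℤ.* dh ℤ.- (g ℤ.* dh) ℤ.* df ≡ 0ℤ
      cancel = solve-∀
      vanishes : ∀ x → evalℤ (addP (mulP (num F) (den H)) (negP (mulP (num H) (den F)))) x ℤ.* evalℤ (den G) x ≡ 0ℤ
      vanishes x = begin
        evalℤ (addP (mulP (num F) (den H)) (negP (mulP (num H) (den F)))) x ℤ.* dg
          ≡⟨ cong (ℤ._* dg) (trans (evalP-addP _ _ x) (cong₂ ℤ._+_ (evalP-mulP (num F) (den H) x)
               (trans (evalP-negP _ x) (cong ℤ.-_ (evalP-mulP (num H) (den F) x))))) ⟩
        (a ℤ.* dh ℤ.- b ℤ.* df) ℤ.* dg
          ≡⟨ rearrange a b df dh dg ⟩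
        (a ℤ.* dg) ℤ.* dh ℤ.- (b ℤ.* dg) ℤ.* df
          ≡⟨ cong₂ (λ u v → u ℤ.* dh ℤ.- v ℤ.* df) (≈F⇒cross F G F≈G x) (sym (≈F⇒cross G H G≈H x)) ⟩
        (g ℤ.* df) ℤ.* dh ℤ.- (g ℤ.* dh) ℤ.* df
          ≡⟨ cancel g df dh ⟩
        0ℤ ∎
        where
        open ≡-Reasoning
        a = evalℤ (num F) x
        b = evalℤ (num H) x
        g = evalℤ (num G) x
        df = evalℤ (den F) x
        dg = evalℤ (den G) x
        dh = evalℤ (den H) x

    +F-cong : ∀ (F F' G G' : Frac n) → F ≈F F' → G ≈F G' → (F +F G) ≈F (F' +F G')
    +F-cong F F' G G' F≈F' G≈G' = ≈F-byEvaluation (F +F G) (F' +F G') λ x →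
      trans (cong₂ ℤ._*_ (evalP-num-+F F G x) (evalP-mulP (den F') (den G') x))
     (trans (cross-+ (evalℤ (num F) x) (evalℤ (den F) x) (evalℤ (num G) x) (evalℤ (den G) x)
                     (evalℤ (num F') x) (evalℤ (den F') x) (evalℤ (num G') x) (evalℤ (den G') x)
                     (≈F⇒cross F F' F≈F' x) (≈F⇒cross G G' G≈G' x))
            (sym (cong₂ ℤ._*_ (evalP-num-+F F' G' x) (evalP-mulP (den F) (den G) x))))

    *F-cong : ∀ (F F' G G' : Frac n) → F ≈F F' → G ≈F G' → (F *F G) ≈F (F' *F G')
    *F-cong F F' G G' F≈F' G≈G' = ≈F-byEvaluation (F *F G) (F' *F G') λ x →
      trans (cong₂ ℤ._*_ (evalP-mulP (num F) (num G) x) (evalP-mulP (den F') (den G') x))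
     (trans (cross-* (evalℤ (num F) x) (evalℤ (den F) x) (evalℤ (num G) x) (evalℤ (den G) x)
                     (evalℤ (num F') x) (evalℤ (den F') x) (evalℤ (num G') x) (evalℤ (den G') x)
                     (≈F⇒cross F F' F≈F' x) (≈F⇒cross G G' G≈G' x))
            (sym (cong₂ ℤ._*_ (evalP-mulP (num F') (num G') x) (evalP-mulP (den F) (den G) x))))

    constF-+F : ∀ a b → (constF {n} a +F constF b) ≈F constF (a ℤ.+ b)
    constF-+F a b = ≈F-byEvaluation (constF a +F constF b) (constF (a ℤ.+ b)) cross
      where
      normalise : ∀ a b → (a ℤ.* 1ℤ ℤ.+ b ℤ.* 1ℤ) ℤ.* 1ℤ ≡ (a ℤ.+ b) ℤ.* (1ℤ ℤ.* 1ℤ)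
      normalise = solve-∀
      cross : ∀ x → CrossAt (constF a +F constF b) (constF (a ℤ.+ b)) x
      cross x = begin
        evalℤ (num (constF a +F constF b)) x ℤ.* evalℤ oneP x
          ≡⟨ cong₂ ℤ._*_ (evalP-num-+F (constF a) (constF b) x) (evalP-constP 1ℤ x) ⟩
        (evalℤ (constP a) x ℤ.* evalℤ oneP x ℤ.+ evalℤ (constP b) x ℤ.* evalℤ oneP x) ℤ.* 1ℤ
          ≡⟨ cong₂ (λ u v → (u ℤ.* evalℤ oneP x ℤ.+ v ℤ.* evalℤ oneP x) ℤ.* 1ℤ) (evalP-constP a x) (evalP-constP b x) ⟩
        (a ℤ.* evalℤ oneP x ℤ.+ b ℤ.* evalℤ oneP x) ℤ.* 1ℤ
          ≡⟨ cong (λ o → (a ℤ.* o ℤ.+ b ℤ.* o) ℤ.* 1ℤ) (evalP-constP 1ℤ x) ⟩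
        (a ℤ.* 1ℤ ℤ.+ b ℤ.* 1ℤ) ℤ.* 1ℤ
          ≡⟨ normalise a b ⟩
        (a ℤ.+ b) ℤ.* (1ℤ ℤ.* 1ℤ)
          ≡⟨ cong₂ ℤ._*_ (evalP-constP (a ℤ.+ b) x) (trans (evalP-mulP oneP oneP x) (cong₂ ℤ._*_ (evalP-constP 1ℤ x) (evalP-constP 1ℤ x))) ⟨
        evalℤ (constP (a ℤ.+ b)) x ℤ.* evalℤ (mulP oneP oneP) x ∎
        where open ≡-Reasoning

open IntegerPoints

open import Data.Rational using (_+_; _*_; _<_)
open +-*-Solver using (solve; _:+_; _:*_; _:=_; con)

fromℤ : ℤ → ℚ
fromℤ z = mkℚ z 0 (Coprimality.sym (Coprimality.1-coprimeTo ∣ z ∣))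

fromℤ-injective : ∀ {a b} → fromℤ a ≡ fromℤ b → a ≡ b
fromℤ-injective = cong ℚ.↥_

fromℤ-≡-/1 : ∀ z → z ℚ./ 1 ≡ fromℤ z
fromℤ-≡-/1 z = ℚP.↥p/↧p≡p (fromℤ z)

fromℤ-+ : ∀ a b → fromℤ (a ℤ.+ b) ≡ fromℤ a + fromℤ b
fromℤ-+ a b = sym (trans (ℚP./-cong (cong₂ ℤ._+_ (ℤP.*-identityʳ a) (ℤP.*-identityʳ b)) refl) (fromℤ-≡-/1 (a ℤ.+ b)))

fromℤ-* : ∀ a b → fromℤ (a ℤ.* b) ≡ fromℤ a * fromℤ b
fromℤ-* a b = sym (fromℤ-≡-/1 (a ℤ.* b))

fromℤ-neg : ∀ a → fromℤ (ℤ.- a) ≡ ℚ.- fromℤ a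
fromℤ-neg (+ zero)  = refl
fromℤ-neg (+ suc n) = refl
fromℤ-neg -[1+ n ]  = refl

fromℤ-isRingHomomorphism : RingMorphisms.IsRingHomomorphism ℤ.+-*-rawRing ℚ.+-*-rawRing fromℤ
fromℤ-isRingHomomorphism = record
  { isSemiringHomomorphism = record
    { isNearSemiringHomomorphism = record
      { +-isMonoidHomomorphism = record
        { isMagmaHomomorphism = record
          { isRelHomomorphism = record { cong = cong fromℤ }
          ; homo = fromℤ-+
          }
        ; ε-homo = refl
        }
      ; *-homo = fromℤ-*
      }
    ; 1#-homo = refl
    }
  ; -‿homo = fromℤ-neg
  }

fromℤ-pos : ∀ {n} → 0 ℕ.< n → 0ℚ < fromℤ (+ n)
fromℤ-pos {suc n} _ = ℚP.positive⁻¹ _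

fromℤ-^ : ∀ x e → fromℤ (+ (x ℕ.^ e)) ≡ fromℤ (+ x) ^ e
fromℤ-^ x zero    = refl
fromℤ-^ x (suc e) = begin
  fromℤ (+ (x ℕ.* x ℕ.^ e))         ≡⟨ cong fromℤ (ℤP.pos-* x (x ℕ.^ e)) ⟩
  fromℤ (+ x ℤ.* + (x ℕ.^ e))       ≡⟨ fromℤ-* (+ x) _ ⟩
  fromℤ (+ x) * fromℤ (+ (x ℕ.^ e)) ≡⟨ cong (fromℤ (+ x) *_) (fromℤ-^ x e) ⟩
  fromℤ (+ x) * fromℤ (+ x) ^ e     ∎
  where open ≡-Reasoning

fromℤ-1+^ : ∀ x e → fromℤ (+ ((1 ℕ.+ x) ℕ.^ e)) ≡ (1ℚ + fromℤ (+ x)) ^ e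
fromℤ-1+^ x e = trans (fromℤ-^ (1 ℕ.+ x) e) (cong (_^ e) (fromℤ-+ 1ℤ (+ x)))

-- The reciprocal, made total by sending 0 to 0; every lemma about it assumes a nonzero argument.
inv : ℚ → ℚ
inv p with p ℚP.≟ 0ℚ
... | yes _   = 0ℚ
... | no p≢0 = (ℚ.1/ p) {{ℚ.≢-nonZero p≢0}}

*-inv : ∀ p → p ≢ 0ℚ → p * inv p ≡ 1ℚ
*-inv p p≢0 with p ℚP.≟ 0ℚ
... | yes p≡0  = contradiction p≡0 p≢0
... | no p≢0′ = ℚP.*-inverseʳ p {{ℚ.≢-nonZero p≢0′}}

inv-unique : ∀ p a → p * a ≡ 1ℚ → a ≡ inv p
inv-unique p a pa≡1 = begin
  a                  ≡⟨ solve 2 (λ a i → a := a :* con 1ℚ) refl a (inv p) ⟩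
  a * 1ℚ             ≡⟨ cong (a *_) (*-inv p p≢0) ⟨
  a * (p * inv p)    ≡⟨ solve 3 (λ a p i → a :* (p :* i) := (p :* a) :* i) refl a p (inv p) ⟩
  (p * a) * inv p    ≡⟨ cong (_* inv p) pa≡1 ⟩
  1ℚ * inv p         ≡⟨ ℚP.*-identityˡ (inv p) ⟩
  inv p              ∎
  where
  open ≡-Reasoning
  p≢0 : p ≢ 0ℚ
  p≢0 p≡0 = ℚP.1≢0 (trans (sym pa≡1) (trans (cong (_* a) p≡0) (ℚP.*-zeroˡ a)))

inv-1 : inv 1ℚ ≡ 1ℚ
inv-1 = sym (inv-unique 1ℚ 1ℚ refl)

inv-involutive : ∀ p → p ≢ 0ℚ → inv (inv p) ≡ p
inv-involutive p p≢0 = sym (inv-unique (inv p) p (trans (ℚP.*-comm (inv p) p) (*-inv p p≢0)))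

inv-* : ∀ p q → p ≢ 0ℚ → q ≢ 0ℚ → inv (p * q) ≡ inv p * inv q
inv-* p q p≢0 q≢0 = sym (inv-unique (p * q) (inv p * inv q) (begin
  (p * q) * (inv p * inv q)   ≡⟨ solve 4 (λ p q i j → (p :* q) :* (i :* j) := (p :* i) :* (q :* j)) refl p q (inv p) (inv q) ⟩
  (p * inv p) * (q * inv q)   ≡⟨ cong₂ _*_ (*-inv p p≢0) (*-inv q q≢0) ⟩
  1ℚ                          ∎))
  where open ≡-Reasoning

*-inv-cross : ∀ a d a' d' → a * d' ≡ a' * d → d ≢ 0ℚ → d' ≢ 0ℚ → a * inv d ≡ a' * inv d'
*-inv-cross a d a' d' ad'≡a'd d≢0 d'≢0 = begin
  a * inv d
    ≡⟨ solve 2 (λ a i → a :* i := (a :* i) :* con 1ℚ) refl a (inv d) ⟩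
  (a * inv d) * 1ℚ
    ≡⟨ cong ((a * inv d) *_) (*-inv d' d'≢0) ⟨
  (a * inv d) * (d' * inv d')
    ≡⟨ solve 4 (λ a i d' j → (a :* i) :* (d' :* j) := (a :* d') :* (i :* j)) refl a (inv d) d' (inv d') ⟩
  (a * d') * (inv d * inv d')
    ≡⟨ cong (_* (inv d * inv d')) ad'≡a'd ⟩
  (a' * d) * (inv d * inv d')
    ≡⟨ solve 4 (λ a' d i j → (a' :* d) :* (i :* j) := (a' :* j) :* (d :* i)) refl a' d (inv d) (inv d') ⟩
  (a' * inv d') * (d * inv d)
    ≡⟨ cong ((a' * inv d') *_) (*-inv d d≢0) ⟩
  (a' * inv d') * 1ℚ
    ≡⟨ ℚP.*-identityʳ _ ⟩
  a' * inv d' ∎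
  where open ≡-Reasoning

>0⇒≢0 : ∀ {p} → 0ℚ < p → p ≢ 0ℚ
>0⇒≢0 0<p p≡0 = ℚP.<⇒≢ 0<p (sym p≡0)

*-pos : ∀ {p q} → 0ℚ < p → 0ℚ < q → 0ℚ < p * q
*-pos {p} {q} 0<p 0<q = ℚP.positive⁻¹ (p * q) {{ℚP.pos*pos⇒pos p {{ℚ.positive 0<p}} q {{ℚ.positive 0<q}}}}

+-pos : ∀ {p q} → 0ℚ < p → 0ℚ < q → 0ℚ < p + q
+-pos {p} {q} 0<p 0<q = ℚP.positive⁻¹ (p + q) {{ℚP.pos+pos⇒pos p {{ℚ.positive 0<p}} q {{ℚ.positive 0<q}}}}

0<1 : 0ℚ < 1ℚ
0<1 = ℚP.positive⁻¹ 1ℚ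

inv-pos : ∀ {p} → 0ℚ < p → 0ℚ < inv p
inv-pos {p} 0<p with p ℚP.≟ 0ℚ
... | yes p≡0 = contradiction p≡0 (>0⇒≢0 0<p)
... | no p≢0  = ℚP.positive⁻¹ _ {{ℚP.1/pos⇒pos p {{ℚ.positive 0<p}}}}

^-pos : ∀ {x} e → 0ℚ < x → 0ℚ < x ^ e
^-pos zero    0<x = 0<1
^-pos (suc e) 0<x = *-pos 0<x (^-pos e 0<x)

inv-^ : ∀ x e → 0ℚ < x → inv (x ^ e) ≡ inv x ^ e
inv-^ x zero    0<x = inv-1
inv-^ x (suc e) 0<x =
  trans (inv-* x (x ^ e) (>0⇒≢0 0<x) (>0⇒≢0 (^-pos e 0<x))) (cong (inv x *_) (inv-^ x e 0<x))

powZQ : ℚ → ℤ → ℚ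
powZQ x (+ e)    = x ^ e
powZQ x -[1+ e ] = inv (x ^ suc e)

product-update : ∀ {r} (i : Fin r) x (g h : Fin r → ℚ) →
  (∀ l → l ≢ i → g l ≡ h l) → g i ≡ x * h i → product g ≡ x * product h
product-update {suc r} i x g h g≡h gi≡xhi = begin
  product g
    ≡⟨ product-remove g ⟩
  g i * product (Vector.removeAt g i)
    ≡⟨ cong₂ _*_ gi≡xhi (product-cong (λ j → g≡h (punchIn i j) (punchInᵢ≢i i j))) ⟩
  (x * h i) * product (Vector.removeAt h i)
    ≡⟨ ℚP.*-assoc x (h i) _ ⟩
  x * (h i * product (Vector.removeAt h i))
    ≡⟨ cong (x *_) (product-remove h) ⟨
  x * product h ∎
  where open ≡-Reasoning

product-ones : ∀ {r} (g : Fin r → ℚ) → (∀ l → g l ≡ 1ℚ) → product g ≡ 1ℚ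
product-ones {zero}  g g≡1 = refl
product-ones {suc r} g g≡1 = trans (cong₂ _*_ (g≡1 zero) (product-ones (g ∘ suc) (g≡1 ∘ suc))) (ℚP.*-identityˡ 1ℚ)

fromℤ-prodFin : ∀ {r} (f : Fin r → ℕ) → fromℤ (+ prodFin f) ≡ product (λ l → fromℤ (+ f l))
fromℤ-prodFin {zero}  f = refl
fromℤ-prodFin {suc r} f = begin
  fromℤ (+ (f zero ℕ.* prodFin (f ∘ suc)))      ≡⟨ cong fromℤ (ℤP.pos-* (f zero) _) ⟩
  fromℤ (+ f zero ℤ.* + prodFin (f ∘ suc))      ≡⟨ fromℤ-* (+ f zero) _ ⟩
  fromℤ (+ f zero) * fromℤ (+ prodFin (f ∘ suc)) ≡⟨ cong (fromℤ (+ f zero) *_) (fromℤ-prodFin (f ∘ suc)) ⟩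
  fromℤ (+ f zero) * product (λ l → fromℤ (+ f (suc l))) ∎
  where open ≡-Reasoning

product-pos : ∀ {r} (g : Fin r → ℚ) → (∀ l → 0ℚ < g l) → 0ℚ < product g
product-pos {zero}  g g>0 = 0<1
product-pos {suc r} g g>0 = *-pos (g>0 zero) (product-pos (g ∘ suc) (g>0 ∘ suc))

inv-^-exchange : ∀ x e → 0ℚ < x → inv x ^ e * inv ((1ℚ + inv x) ^ e) ≡ inv ((1ℚ + x) ^ e)
inv-^-exchange x e 0<x = begin
  inv x ^ e * inv ((1ℚ + inv x) ^ e)     ≡⟨ cong (inv x ^ e *_) (inv-^ (1ℚ + inv x) e 0<1+x⁻¹) ⟩
  inv x ^ e * inv (1ℚ + inv x) ^ e       ≡⟨ ^-distrib-* (inv x) (inv (1ℚ + inv x)) e ⟨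
  (inv x * inv (1ℚ + inv x)) ^ e         ≡⟨ cong (_^ e) (inv-* x (1ℚ + inv x) (>0⇒≢0 0<x) (>0⇒≢0 0<1+x⁻¹)) ⟨
  inv (x * (1ℚ + inv x)) ^ e             ≡⟨ cong (λ y → inv y ^ e) x[1+x⁻¹]≡1+x ⟩
  inv (1ℚ + x) ^ e                       ≡⟨ inv-^ (1ℚ + x) e (+-pos 0<1 0<x) ⟨
  inv ((1ℚ + x) ^ e)                     ∎
  where
  open ≡-Reasoning
  0<1+x⁻¹ = +-pos 0<1 (inv-pos 0<x)
  x[1+x⁻¹]≡1+x : x * (1ℚ + inv x) ≡ 1ℚ + x
  x[1+x⁻¹]≡1+x = begin
    x * (1ℚ + inv x)   ≡⟨ solve 2 (λ x i → x :* (con 1ℚ :+ i) := x :* i :+ x) refl x (inv x) ⟩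
    x * inv x + x      ≡⟨ cong (_+ x) (*-inv x (>0⇒≢0 0<x)) ⟩
    1ℚ + x             ∎

exchange-nonpos : ∀ x a → a ℤ.≤ 0ℤ → powZQ x [ a ]₊ * powZQ (1ℚ + x) (ℤ.- a) ≡ (1ℚ + x) ^ ∣ a ∣
exchange-nonpos x (+ zero)  _ = ℚP.*-identityˡ 1ℚ
exchange-nonpos x -[1+ n ]  _ = ℚP.*-identityˡ _
exchange-nonpos x (+ suc n) (ℤ.+≤+ ())

exchange-inv-nonpos : ∀ x a → 0ℚ < x → a ℤ.≤ 0ℤ →
  powZQ (inv x) [ ℤ.- a ]₊ * powZQ (1ℚ + inv x) (ℤ.- (ℤ.- a)) ≡ inv ((1ℚ + x) ^ ∣ a ∣)
exchange-inv-nonpos x (+ zero)  0<x _ = trans (ℚP.*-identityˡ 1ℚ) (sym inv-1)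
exchange-inv-nonpos x -[1+ n ]  0<x _ = inv-^-exchange x (suc n) 0<x
exchange-inv-nonpos x (+ suc n) 0<x (ℤ.+≤+ ())

-- Matrix mutation along the belt

<ᵇ-true : ∀ {m n} → m ℕ.< n → (m ℕ.<ᵇ n) ≡ true
<ᵇ-true {m} {n} = dec-true (m ℕ.<? n)

<ᵇ-false : ∀ {m n} → ¬ m ℕ.< n → (m ℕ.<ᵇ n) ≡ false
<ᵇ-false {m} {n} = dec-false (m ℕ.<? n)

<suc∧≢⇒< : ∀ {n s} → n ℕ.< suc s → n ≢ s → n ℕ.< s
<suc∧≢⇒< n<1+s n≢s = ℕP.≤∧≢⇒< (ℕP.m<1+n⇒m≤n n<1+s) n≢s

≮∧≢⇒> : ∀ {n s} → ¬ n ℕ.< s → n ≢ s → s ℕ.< n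
≮∧≢⇒> n≮s n≢s = ℕP.≤∧≢⇒< (ℕP.≮⇒≥ n≮s) (n≢s ∘ sym)

[]₊-nonpos : ∀ a → a ℤ.≤ 0ℤ → [ a ]₊ ≡ 0ℤ
[]₊-nonpos (+ zero)  _ = refl
[]₊-nonpos -[1+ n ]  _ = refl
[]₊-nonpos (+ suc n) (ℤ.+≤+ ())

record InWindow (a b n : ℕ) : Set where
  constructor within
  field
    lower : a ℕ.≤ n
    upper : n ℕ.< b

inWindow? : ∀ a b n → Dec (InWindow a b n)
inWindow? a b n = map′ (uncurry within) (λ (within p q) → p , q) (a ℕ.≤? n ×-dec n ℕ.<? b)

module _ {r : ℕ} where

  ≟F-≡ : ∀ {i j : Fin r} → i ≡ j → (i ≟F j) ≡ true
  ≟F-≡ {i} {j} i≡j = dec-true (toℕ i ℕ.≟ toℕ j) (cong toℕ i≡j)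

  ≟F-≢ : ∀ {i j : Fin r} → i ≢ j → (i ≟F j) ≡ false
  ≟F-≢ {i} {j} i≢j = dec-false (toℕ i ℕ.≟ toℕ j) (i≢j ∘ toℕ-injective)

  μB-≡ : ∀ k (B : Mat r) i j → i ≡ k ⊎ j ≡ k → μB k B i j ≡ ℤ.- B i j
  μB-≡ k B i j (inj₁ i≡k) rewrite ≟F-≡ i≡k = refl
  μB-≡ k B i j (inj₂ j≡k) rewrite ≟F-≡ j≡k | ∨-zeroʳ (i ≟F k) = refl

  μB-≢ : ∀ k (B : Mat r) i j → i ≢ k → j ≢ k →
    μB k B i j ≡ B i j ℤ.+ [ B i k ]₊ ℤ.* [ B k j ]₊ ℤ.- [ ℤ.- B i k ]₊ ℤ.* [ ℤ.- B k j ]₊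
  μB-≢ k B i j i≢k j≢k rewrite ≟F-≢ i≢k | ≟F-≢ j≢k = refl

  μB-cong : ∀ k {B B' : Mat r} → (∀ i j → B i j ≡ B' i j) → ∀ i j → μB k B i j ≡ μB k B' i j
  μB-cong k B≗B' i j rewrite B≗B' i j | B≗B' i k | B≗B' k j = refl

  μB-involutive : ∀ k (B : Mat r) i j → μB k (μB k B) i j ≡ B i j
  μB-involutive k B i j with i Fin.≟ k | j Fin.≟ k
  ... | yes i≡k | _ = trans (μB-≡ k (μB k B) i j (inj₁ i≡k))
                            (trans (cong ℤ.-_ (μB-≡ k B i j (inj₁ i≡k))) (ℤP.neg-involutive _))
  ... | no _ | yes j≡k = trans (μB-≡ k (μB k B) i j (inj₂ j≡k))
                               (trans (cong ℤ.-_ (μB-≡ k B i j (inj₂ j≡k))) (ℤP.neg-involutive _))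
  ... | no i≢k | no j≢k = begin
    μB k B' i j
      ≡⟨ μB-≢ k B' i j i≢k j≢k ⟩
    B' i j ℤ.+ [ B' i k ]₊ ℤ.* [ B' k j ]₊ ℤ.- [ ℤ.- B' i k ]₊ ℤ.* [ ℤ.- B' k j ]₊
      ≡⟨ cong₂ (λ u v → B' i j ℤ.+ [ u ]₊ ℤ.* [ v ]₊ ℤ.- [ ℤ.- u ]₊ ℤ.* [ ℤ.- v ]₊)
               (μB-≡ k B i k (inj₂ refl)) (μB-≡ k B k j (inj₁ refl)) ⟩
    B' i j ℤ.+ [ ℤ.- B i k ]₊ ℤ.* [ ℤ.- B k j ]₊ ℤ.- [ ℤ.- (ℤ.- B i k) ]₊ ℤ.* [ ℤ.- (ℤ.- B k j) ]₊
      ≡⟨ cong₂ (λ u v → u ℤ.+ [ ℤ.- B i k ]₊ ℤ.* [ ℤ.- B k j ]₊ ℤ.- v) (μB-≢ k B i j i≢k j≢k)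
               (cong₂ (λ u v → [ u ]₊ ℤ.* [ v ]₊) (ℤP.neg-involutive (B i k)) (ℤP.neg-involutive (B k j))) ⟩
    (B i j ℤ.+ [ B i k ]₊ ℤ.* [ B k j ]₊ ℤ.- [ ℤ.- B i k ]₊ ℤ.* [ ℤ.- B k j ]₊)
      ℤ.+ [ ℤ.- B i k ]₊ ℤ.* [ ℤ.- B k j ]₊ ℤ.- [ B i k ]₊ ℤ.* [ B k j ]₊
      ≡⟨ cancel (B i j) ([ B i k ]₊ ℤ.* [ B k j ]₊) ([ ℤ.- B i k ]₊ ℤ.* [ ℤ.- B k j ]₊) ⟩
    B i j ∎
    where
    open ≡-Reasoning
    B' = μB k B
    cancel : ∀ b p n → (b ℤ.+ p ℤ.- n) ℤ.+ n ℤ.- p ≡ b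
    cancel = solve-∀

  toℕ-≢ : ∀ {i l : Fin r} {s} → toℕ i ≡ s → l ≢ i → toℕ l ≢ s
  toℕ-≢ i≡s l≢i l≡s = l≢i (toℕ-injective (trans l≡s (sym i≡s)))

  module _ (A : Mat r) where

    BA-< : ∀ {j l} → toℕ j ℕ.< toℕ l → BA A j l ≡ A j l
    BA-< j<l rewrite <ᵇ-true j<l = refl

    BA-> : ∀ {j l} → toℕ l ℕ.< toℕ j → BA A j l ≡ ℤ.- A j l
    BA-> l<j rewrite <ᵇ-false (ℕP.<-asym l<j) | <ᵇ-true l<j = refl

    BA-diag : ∀ j → BA A j j ≡ 0ℤ
    BA-diag j rewrite <ᵇ-false (ℕP.<-irrefl {toℕ j} refl) = refl

    -- The exchange matrix at t(s+1, m): B_A with the signs between {j | j < s} and its complement reversed.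
    flipB : ℕ → Mat r
    flipB s j l with toℕ j ℕ.<? s | toℕ l ℕ.<? s
    ... | yes _ | yes _ = BA A j l
    ... | no _  | no _  = BA A j l
    ... | yes _ | no _  = ℤ.- BA A j l
    ... | no _  | yes _ = ℤ.- BA A j l

    flipB-0 : ∀ j l → flipB 0 j l ≡ BA A j l
    flipB-0 j l with toℕ j ℕ.<? 0 | toℕ l ℕ.<? 0
    ... | no _ | no _ = refl
    ... | yes () | _
    ... | no _ | yes ()

    flipB-r : ∀ j l → flipB r j l ≡ BA A j l
    flipB-r j l with toℕ j ℕ.<? r | toℕ l ℕ.<? r
    ... | yes _ | yes _ = refl
    ... | no j≮r | _ = contradiction (toℕ<n j) j≮r
    ... | yes _ | no l≮r = contradiction (toℕ<n l) l≮r

    flipB-diag : ∀ s j → flipB s j j ≡ 0ℤ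
    flipB-diag s j with toℕ j ℕ.<? s
    ... | yes _ = BA-diag j
    ... | no _  = BA-diag j

    module _ {i : Fin r} {s : ℕ} (i≡s : toℕ i ≡ s) where

      flipB-row : ∀ {l} → l ≢ i → flipB s i l ≡ A i l
      flipB-row {l} l≢i with toℕ i ℕ.<? s | toℕ l ℕ.<? s
      ... | yes i<s | _ = contradiction i<s (ℕP.<-irrefl i≡s)
      ... | no _ | yes l<s = trans (cong ℤ.-_ (BA-> (subst (toℕ l ℕ.<_) (sym i≡s) l<s))) (ℤP.neg-involutive _)
      ... | no _ | no l≮s = BA-< (subst (ℕ._< toℕ l) (sym i≡s) (≮∧≢⇒> l≮s (toℕ-≢ i≡s l≢i)))

      flipB-col : ∀ {j} → j ≢ i → flipB s j i ≡ ℤ.- A j i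
      flipB-col {j} j≢i with toℕ j ℕ.<? s | toℕ i ℕ.<? s
      ... | _ | yes i<s = contradiction i<s (ℕP.<-irrefl i≡s)
      ... | yes j<s | no _ = cong ℤ.-_ (BA-< (subst (toℕ j ℕ.<_) (sym i≡s) j<s))
      ... | no j≮s | no _ = BA-> (subst (ℕ._< toℕ j) (sym i≡s) (≮∧≢⇒> j≮s (toℕ-≢ i≡s j≢i)))

      flipB-suc-row : ∀ {l} → l ≢ i → flipB (suc s) i l ≡ ℤ.- A i l
      flipB-suc-row {l} l≢i with toℕ i ℕ.<? suc s | toℕ l ℕ.<? suc s
      ... | no i≮1+s | _ = contradiction (ℕP.≤-reflexive (cong suc i≡s)) i≮1+s
      ... | yes _ | yes l<1+s = BA-> (subst (toℕ l ℕ.<_) (sym i≡s) (<suc∧≢⇒< l<1+s (toℕ-≢ i≡s l≢i)))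
      ... | yes _ | no l≮1+s = cong ℤ.-_ (BA-< (subst (ℕ._< toℕ l) (sym i≡s) (ℕP.≰⇒> (l≮1+s ∘ ℕ.s≤s))))

      flipB-suc-col : ∀ {j} → j ≢ i → flipB (suc s) j i ≡ A j i
      flipB-suc-col {j} j≢i with toℕ j ℕ.<? suc s | toℕ i ℕ.<? suc s
      ... | _ | no i≮1+s = contradiction (ℕP.≤-reflexive (cong suc i≡s)) i≮1+s
      ... | yes j<1+s | yes _ = BA-< (subst (toℕ j ℕ.<_) (sym i≡s) (<suc∧≢⇒< j<1+s (toℕ-≢ i≡s j≢i)))
      ... | no j≮1+s | yes _ =
        trans (cong ℤ.-_ (BA-> (subst (ℕ._< toℕ j) (sym i≡s) (ℕP.≰⇒> (j≮1+s ∘ ℕ.s≤s))))) (ℤP.neg-involutive _)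

      flipB-suc-other : ∀ {j l} → j ≢ i → l ≢ i → flipB (suc s) j l ≡ flipB s j l
      flipB-suc-other {j} {l} j≢i l≢i
        with toℕ j ℕ.<? suc s | toℕ l ℕ.<? suc s | toℕ j ℕ.<? s | toℕ l ℕ.<? s
      ... | yes _ | yes _ | yes _ | yes _ = refl
      ... | no _  | no _  | no _  | no _  = refl
      ... | yes _ | no _  | yes _ | no _  = refl
      ... | no _  | yes _ | no _  | yes _ = refl
      ... | yes j<1+s | _ | no j≮s | _ = contradiction (<suc∧≢⇒< j<1+s (toℕ-≢ i≡s j≢i)) j≮s
      ... | no j≮1+s  | _ | yes j<s | _ = contradiction (ℕP.m<n⇒m<1+n j<s) j≮1+s
      ... | _ | yes l<1+s | _ | no l≮s = contradiction (<suc∧≢⇒< l<1+s (toℕ-≢ i≡s l≢i)) l≮s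
      ... | _ | no l≮1+s | _ | yes l<s = contradiction (ℕP.m<n⇒m<1+n l<s) l≮1+s

    module _ (A-offdiag : ∀ i j → i ≢ j → A i j ℤ.≤ 0ℤ) {i : Fin r} {s : ℕ} (i≡s : toℕ i ≡ s) where

      μB-flipB : ∀ j l → μB i (flipB s) j l ≡ flipB (suc s) j l
      μB-flipB j l with j Fin.≟ i | l Fin.≟ i
      ... | yes refl | yes refl = trans (μB-≡ j (flipB s) j j (inj₁ refl))
                                        (trans (cong ℤ.-_ (flipB-diag s j)) (sym (flipB-diag (suc s) j)))
      ... | yes refl | no l≢i = trans (μB-≡ j (flipB s) j l (inj₁ refl))
                                      (trans (cong ℤ.-_ (flipB-row i≡s l≢i)) (sym (flipB-suc-row i≡s l≢i)))
      ... | no j≢i | yes refl = trans (μB-≡ l (flipB s) j l (inj₂ refl))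
                                      (trans (cong ℤ.-_ (flipB-col i≡s j≢i))
                                      (trans (ℤP.neg-involutive _) (sym (flipB-suc-col i≡s j≢i))))
      ... | no j≢i | no l≢i = begin
        μB i (flipB s) j l
          ≡⟨ μB-≢ i (flipB s) j l j≢i l≢i ⟩
        flipB s j l ℤ.+ [ flipB s j i ]₊ ℤ.* [ flipB s i l ]₊ ℤ.- [ ℤ.- flipB s j i ]₊ ℤ.* [ ℤ.- flipB s i l ]₊
          ≡⟨ cong₂ (λ u v → flipB s j l ℤ.+ [ flipB s j i ]₊ ℤ.* u ℤ.- v ℤ.* [ ℤ.- flipB s i l ]₊)
                   (trans (cong [_]₊ (flipB-row i≡s l≢i)) ([]₊-nonpos _ (A-offdiag i l (l≢i ∘ sym))))
                   (trans (cong (λ u → [ ℤ.- u ]₊) (flipB-col i≡s j≢i))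
                          (trans (cong [_]₊ (ℤP.neg-involutive _)) ([]₊-nonpos _ (A-offdiag j i j≢i)))) ⟩
        flipB s j l ℤ.+ [ flipB s j i ]₊ ℤ.* 0ℤ ℤ.- 0ℤ ℤ.* [ ℤ.- flipB s i l ]₊
          ≡⟨ drop-zeros (flipB s j l) [ flipB s j i ]₊ [ ℤ.- flipB s i l ]₊ ⟩
        flipB s j l
          ≡⟨ flipB-suc-other i≡s j≢i l≢i ⟨
        flipB (suc s) j l ∎
        where
        open ≡-Reasoning
        drop-zeros : ∀ b x y → b ℤ.+ x ℤ.* 0ℤ ℤ.- 0ℤ ℤ.* y ≡ b
        drop-zeros = solve-∀

      μB-flipB-suc : ∀ j l → μB i (flipB (suc s)) j l ≡ flipB s j l
      μB-flipB-suc j l = trans (μB-cong i (λ j l → sym (μB-flipB j l)) j l) (μB-involutive i (flipB s) j l)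

module _ {r : ℕ} where

  restrict : ℕ → ℕ → (Fin r → ℚ) → Fin r → ℚ
  restrict a b f l = if does (inWindow? a b (toℕ l)) then f l else 1ℚ

  window : ℕ → ℕ → (Fin r → ℚ) → ℚ
  window a b f = product (restrict a b f)

  module _ (f : Fin r → ℚ) where

    restrict-in : ∀ {a b l} → InWindow a b (toℕ l) → restrict a b f l ≡ f l
    restrict-in {a} {b} {l} in-ab rewrite dec-true (inWindow? a b (toℕ l)) in-ab = refl

    restrict-out : ∀ a b {l} → ¬ InWindow a b (toℕ l) → restrict a b f l ≡ 1ℚ
    restrict-out a b {l} ∉ab rewrite dec-false (inWindow? a b (toℕ l)) ∉ab = refl

    restrict-cong : ∀ a b a' b' {l} → (InWindow a b (toℕ l) → InWindow a' b' (toℕ l)) →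
      (InWindow a' b' (toℕ l) → InWindow a b (toℕ l)) → restrict a b f l ≡ restrict a' b' f l
    restrict-cong a b a' b' {l} to from with inWindow? a b (toℕ l)
    ... | yes in-ab = trans (restrict-in in-ab) (sym (restrict-in (to in-ab)))
    ... | no ∉ab    = trans (restrict-out a b ∉ab) (sym (restrict-out a' b' (∉ab ∘ from)))

  window-empty : ∀ {a b} f → b ℕ.≤ a → window a b f ≡ 1ℚ
  window-empty {a} {b} f b≤a = product-ones (restrict a b f) λ l →
    restrict-out f a b λ (within a≤l l<b) → ℕP.<⇒≱ l<b (ℕP.≤-trans b≤a a≤l)

  module _ (f : Fin r → ℚ) {i : Fin r} {s : ℕ} (i≡s : toℕ i ≡ s) where

    window-extendʳ : ∀ {a} → a ℕ.≤ s → window a (suc s) f ≡ f i * window a s f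
    window-extendʳ {a} a≤s = product-update i (f i) (restrict a (suc s) f) (restrict a s f)
      (λ l l≢i → restrict-cong f a (suc s) a s (λ (within a≤l l<1+s) → within a≤l (<suc∧≢⇒< l<1+s (toℕ-≢ i≡s l≢i)))
                                 (λ (within a≤l l<s) → within a≤l (ℕP.m<n⇒m<1+n l<s)))
      (begin
        restrict a (suc s) f i  ≡⟨ restrict-in f (within (subst (a ℕ.≤_) (sym i≡s) a≤s) (ℕP.≤-reflexive (cong suc i≡s))) ⟩
        f i                     ≡⟨ ℚP.*-identityʳ (f i) ⟨
        f i * 1ℚ                ≡⟨ cong (f i *_) (restrict-out f a s (λ (within _ i<s) → ℕP.<-irrefl i≡s i<s)) ⟨
        f i * restrict a s f i  ∎)
      where open ≡-Reasoning

    window-extendˡ : ∀ {b} → s ℕ.< b → window s b f ≡ f i * window (suc s) b f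
    window-extendˡ {b} s<b = product-update i (f i) (restrict s b f) (restrict (suc s) b f)
      (λ l l≢i → restrict-cong f s b (suc s) b (λ (within s≤l l<b) → within (ℕP.≤∧≢⇒< s≤l (toℕ-≢ i≡s l≢i ∘ sym)) l<b)
                                 (λ (within s<l l<b) → within (ℕP.<⇒≤ s<l) l<b))
      (begin
        restrict s b f i             ≡⟨ restrict-in f (within (ℕP.≤-reflexive (sym i≡s)) (subst (ℕ._< b) (sym i≡s) s<b)) ⟩
        f i                          ≡⟨ ℚP.*-identityʳ (f i) ⟨
        f i * 1ℚ                     ≡⟨ cong (f i *_) (restrict-out f (suc s) b (λ (within s<i _) → ℕP.<-irrefl (sym i≡s) s<i)) ⟨
        f i * restrict (suc s) b f i ∎)
      where open ≡-Reasoning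

  window-pos : ∀ a b f → (∀ l → 0ℚ < f l) → 0ℚ < window a b f
  window-pos a b f f>0 = product-pos (restrict a b f) restrict-pos
    where
    restrict-pos : ∀ l → 0ℚ < restrict a b f l
    restrict-pos l with does (inWindow? a b (toℕ l))
    ... | true  = f>0 l
    ... | false = 0<1

data Ascending {r : ℕ} : ℕ → ℕ → List (Fin r) → Set where
  []  : ∀ {s} → Ascending s s []
  _∷_ : ∀ {s e i L} → toℕ i ≡ s → Ascending (suc s) e L → Ascending s e (i ∷ L)

data Descending {r : ℕ} : ℕ → ℕ → List (Fin r) → Set where
  []  : ∀ {t} → Descending t t []
  _∷_ : ∀ {t u i L} → toℕ i ≡ t → Descending t u L → Descending (suc t) u (i ∷ L)

module _ {r : ℕ} where

  tabulate-ascending : ∀ {n} s (f : Fin n → Fin r) → (∀ i → toℕ (f i) ≡ s ℕ.+ toℕ i) →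
    Ascending s (s ℕ.+ n) (tabulate f)
  tabulate-ascending {zero}  s f f≡ = subst (λ e → Ascending {r} s e []) (sym (ℕP.+-identityʳ s)) []
  tabulate-ascending {suc n} s f f≡ =
    trans (f≡ zero) (ℕP.+-identityʳ s) ∷
    subst (λ e → Ascending (suc s) e (tabulate (f ∘ suc))) (sym (ℕP.+-suc s n))
      (tabulate-ascending (suc s) (f ∘ suc) (λ i → trans (f≡ (suc i)) (ℕP.+-suc s (toℕ i))))

  allFin-ascending : Ascending 0 r (allFin r)
  allFin-ascending = tabulate-ascending 0 id (λ i → refl)

  take-ascending : ∀ {s e} {L : List (Fin r)} → Ascending s e L → ∀ t → s ℕ.+ t ℕ.≤ e →
    Ascending s (s ℕ.+ t) (take t L)
  take-ascending {s} asc zero _ = subst (λ e → Ascending {r} s e []) (sym (ℕP.+-identityʳ s)) []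
  take-ascending {s} [] (suc t) s+1+t≤s = contradiction s+1+t≤s (ℕP.m+1+n≰m s)
  take-ascending {s} {e} (_∷_ {L = L} i≡s asc) (suc t) s+1+t≤e =
    i≡s ∷ subst (λ e → Ascending (suc s) e (take t L)) (sym (ℕP.+-suc s t))
                (take-ascending asc t (subst (ℕ._≤ e) (ℕP.+-suc s t) s+1+t≤e))

  ++-descending : ∀ {t u v} {L₁ L₂ : List (Fin r)} → Descending t u L₁ → Descending u v L₂ →
    Descending t v (L₁ ++ L₂)
  ++-descending []            desc₂ = desc₂
  ++-descending (i≡t ∷ desc₁) desc₂ = i≡t ∷ ++-descending desc₁ desc₂

  reverse-ascending : ∀ {s e} {L : List (Fin r)} → Ascending s e L → Descending e s (reverse L)
  reverse-ascending [] = []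
  reverse-ascending {s} {e} (_∷_ {i = i} {L} i≡s asc) =
    subst (Descending e s) (sym (unfold-reverse i L)) (++-descending (reverse-ascending asc) (i≡s ∷ []))

  descending-≤ : ∀ {t u} {L : List (Fin r)} → Descending t u L → u ℕ.≤ t
  descending-≤ []         = ℕP.≤-refl
  descending-≤ (_ ∷ desc) = ℕP.m≤n⇒m≤1+n (descending-≤ desc)

  take-descending : ∀ {t u} {L : List (Fin r)} → Descending t u L → ∀ n → n ℕ.≤ t ℕ.∸ u →
    Descending t (t ℕ.∸ n) (take n L)
  take-descending desc zero _ = []
  take-descending {t} [] (suc n) 1+n≤t∸t = contradiction (subst (suc n ℕ.≤_) (ℕP.n∸n≡0 t) 1+n≤t∸t) λ ()
  take-descending {suc t} {u} (i≡t ∷ desc) (suc n) 1+n≤1+t∸u =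
    i≡t ∷ take-descending desc n (ℕP.≤-pred (subst (suc n ℕ.≤_) (ℕP.+-∸-assoc 1 (descending-≤ desc)) 1+n≤1+t∸u))

-- Y-seeds evaluated at a positive point

QSeed : ℕ → Set
QSeed r = Mat r × (Fin r → ℚ)

μQ : ∀ {r} → Fin r → QSeed r → QSeed r
μQ k (B , v) = μB k B , v'
  where
  v' : _ → ℚ
  v' j = if j ≟F k then inv (v k)
         else v j * (powZQ (v k) [ B k j ]₊ * powZQ (1ℚ + v k) (ℤ.- B k j))

seedQ : ∀ {r} → QSeed r → List (Fin r) → QSeed r
seedQ q w = foldl (λ s k → μQ k s) q w

μQ-self : ∀ {r} k (q : QSeed r) → proj₂ (μQ k q) k ≡ inv (proj₂ q k)
μQ-self k q rewrite ≟F-≡ {i = k} refl = refl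

μQ-other : ∀ {r} k (q : QSeed r) {j} → j ≢ k →
  proj₂ (μQ k q) j ≡ proj₂ q j * (powZQ (proj₂ q k) [ proj₁ q k j ]₊ * powZQ (1ℚ + proj₂ q k) (ℤ.- proj₁ q k j))
μQ-other k q j≢k rewrite ≟F-≢ j≢k = refl

seedQ-++ : ∀ {r} (q : QSeed r) xs ys → seedQ q (xs ++ ys) ≡ seedQ (seedQ q xs) ys
seedQ-++ q xs ys = foldl-++ (λ s k → μQ k s) q xs ys

module AtPoint {r : ℕ} (c : Fin r → ℚ) where

  open Evaluation ℚP.+-*-commutativeRing fromℤ fromℤ-isRingHomomorphism
    renaming (evalP to evalℚ)

  evalF : Frac r → ℚ
  evalF F = evalℚ (num F) c * inv (evalℚ (den F) c)

  PositiveDen : Frac r → Set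
  PositiveDen F = 0ℚ < evalℚ (den F) c

  Positive : Frac r → Set
  Positive F = 0ℚ < evalℚ (num F) c × PositiveDen F

  PositiveDen⇒den≢0 : ∀ F → PositiveDen F → ¬ IsZeroP (den F)
  PositiveDen⇒den≢0 F 0<d d≡0 = >0⇒≢0 0<d (evalP-IsZeroP (den F) c d≡0)

  evalℚ-oneP : evalℚ oneP c ≡ 1ℚ
  evalℚ-oneP = evalP-constP 1ℤ c

  PositiveDen-constF : ∀ z → PositiveDen (constF z)
  PositiveDen-constF z = subst (0ℚ <_) (sym evalℚ-oneP) 0<1

  PositiveDen-+F : ∀ F G → PositiveDen F → PositiveDen G → PositiveDen (F +F G)
  PositiveDen-+F F G 0<dF 0<dG = subst (0ℚ <_) (sym (evalP-mulP (den F) (den G) c)) (*-pos 0<dF 0<dG)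

  PositiveDen-*F : ∀ F G → PositiveDen F → PositiveDen G → PositiveDen (F *F G)
  PositiveDen-*F = PositiveDen-+F

  Positive-1F : Positive 1F
  Positive-1F = PositiveDen-constF 1ℤ , PositiveDen-constF 1ℤ

  Positive-+F : ∀ F G → Positive F → Positive G → Positive (F +F G)
  Positive-+F F G (0<nF , 0<dF) (0<nG , 0<dG) =
    subst (0ℚ <_) (sym (evalP-num-+F F G c)) (+-pos (*-pos 0<nF 0<dG) (*-pos 0<nG 0<dF)) ,
    PositiveDen-+F F G 0<dF 0<dG

  Positive-*F : ∀ F G → Positive F → Positive G → Positive (F *F G)
  Positive-*F F G (0<nF , 0<dF) (0<nG , 0<dG) =
    subst (0ℚ <_) (sym (evalP-mulP (num F) (num G) c)) (*-pos 0<nF 0<nG) ,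
    PositiveDen-*F F G 0<dF 0<dG

  Positive-invF : ∀ F → Positive F → Positive (invF F)
  Positive-invF (p / q) (0<p , 0<q) = 0<q , 0<p

  Positive-powF : ∀ F e → Positive F → Positive (powF F e)
  Positive-powF F zero    F>0 = Positive-1F
  Positive-powF F (suc e) F>0 = Positive-*F F (powF F e) F>0 (Positive-powF F e F>0)

  Positive-powZF : ∀ F z → Positive F → Positive (powZF F z)
  Positive-powZF F (+ e)    F>0 = Positive-powF F e F>0
  Positive-powZF F -[1+ e ] F>0 = Positive-invF (powF F (suc e)) (Positive-powF F (suc e) F>0)

  evalF-+F : ∀ F G → PositiveDen F → PositiveDen G → evalF (F +F G) ≡ evalF F + evalF G
  evalF-+F F G 0<dF 0<dG = begin
    evalℚ (num (F +F G)) c * inv (evalℚ (den (F +F G)) c)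
      ≡⟨ cong₂ (λ u v → u * inv v) (evalP-num-+F F G c) (evalP-mulP (den F) (den G) c) ⟩
    (a * dG + b * dF) * inv (dF * dG)
      ≡⟨ cong ((a * dG + b * dF) *_) (inv-* dF dG (>0⇒≢0 0<dF) (>0⇒≢0 0<dG)) ⟩
    (a * dG + b * dF) * (inv dF * inv dG)
      ≡⟨ solve 6 (λ a b dF dG i j → (a :* dG :+ b :* dF) :* (i :* j) := (a :* i) :* (dG :* j) :+ (b :* j) :* (dF :* i))
           refl a b dF dG (inv dF) (inv dG) ⟩
    (a * inv dF) * (dG * inv dG) + (b * inv dG) * (dF * inv dF)
      ≡⟨ cong₂ (λ u v → (a * inv dF) * u + (b * inv dG) * v) (*-inv dG (>0⇒≢0 0<dG)) (*-inv dF (>0⇒≢0 0<dF)) ⟩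
    (a * inv dF) * 1ℚ + (b * inv dG) * 1ℚ
      ≡⟨ cong₂ _+_ (ℚP.*-identityʳ (a * inv dF)) (ℚP.*-identityʳ (b * inv dG)) ⟩
    a * inv dF + b * inv dG ∎
    where
    open ≡-Reasoning
    a = evalℚ (num F) c
    b = evalℚ (num G) c
    dF = evalℚ (den F) c
    dG = evalℚ (den G) c

  evalF-*F : ∀ F G → PositiveDen F → PositiveDen G → evalF (F *F G) ≡ evalF F * evalF G
  evalF-*F F G 0<dF 0<dG = begin
    evalℚ (num (F *F G)) c * inv (evalℚ (den (F *F G)) c)
      ≡⟨ cong₂ (λ u v → u * inv v) (evalP-mulP (num F) (num G) c) (evalP-mulP (den F) (den G) c) ⟩
    (a * b) * inv (dF * dG)
      ≡⟨ cong ((a * b) *_) (inv-* dF dG (>0⇒≢0 0<dF) (>0⇒≢0 0<dG)) ⟩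
    (a * b) * (inv dF * inv dG)
      ≡⟨ solve 4 (λ a b i j → (a :* b) :* (i :* j) := (a :* i) :* (b :* j)) refl a b (inv dF) (inv dG) ⟩
    (a * inv dF) * (b * inv dG) ∎
    where
    open ≡-Reasoning
    a = evalℚ (num F) c
    b = evalℚ (num G) c
    dF = evalℚ (den F) c
    dG = evalℚ (den G) c

  evalF-constF : ∀ z → evalF (constF z) ≡ fromℤ z
  evalF-constF z = trans (cong₂ (λ u v → u * inv v) (evalP-constP z c) evalℚ-oneP)
                         (trans (cong (fromℤ z *_) inv-1) (ℚP.*-identityʳ _))

  evalF-1F : evalF 1F ≡ 1ℚ
  evalF-1F = evalF-constF 1ℤ

  evalF-invF : ∀ F → Positive F → evalF (invF F) ≡ inv (evalF F)
  evalF-invF (p / q) (0<p , 0<q) = begin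
    evalℚ q c * inv (evalℚ p c)              ≡⟨ cong (_* inv (evalℚ p c)) (inv-involutive (evalℚ q c) (>0⇒≢0 0<q)) ⟨
    inv (inv (evalℚ q c)) * inv (evalℚ p c)  ≡⟨ inv-* (inv (evalℚ q c)) (evalℚ p c) (>0⇒≢0 (inv-pos 0<q)) (>0⇒≢0 0<p) ⟨
    inv (inv (evalℚ q c) * evalℚ p c)        ≡⟨ cong inv (ℚP.*-comm (inv (evalℚ q c)) (evalℚ p c)) ⟩
    inv (evalℚ p c * inv (evalℚ q c))        ∎
    where open ≡-Reasoning

  evalF-powF : ∀ F e → Positive F → evalF (powF F e) ≡ evalF F ^ e
  evalF-powF F zero    F>0 = evalF-1F
  evalF-powF F (suc e) F>0 =
    trans (evalF-*F F (powF F e) (proj₂ F>0) (proj₂ (Positive-powF F e F>0)))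
          (cong (evalF F *_) (evalF-powF F e F>0))

  evalF-powZF : ∀ F z → Positive F → evalF (powZF F z) ≡ powZQ (evalF F) z
  evalF-powZF F (+ e)    F>0 = evalF-powF F e F>0
  evalF-powZF F -[1+ e ] F>0 =
    trans (evalF-invF (powF F (suc e)) (Positive-powF F (suc e) F>0)) (cong inv (evalF-powF F (suc e) F>0))

  evalF-cong : ∀ F G → F ≈F G → PositiveDen F → PositiveDen G → evalF F ≡ evalF G
  evalF-cong F G F≈G 0<dF 0<dG =
    *-inv-cross (evalℚ (num F) c) (evalℚ (den F) c) (evalℚ (num G) c) (evalℚ (den G) c) (≈F⇒cross F G F≈G c) (>0⇒≢0 0<dF) (>0⇒≢0 0<dG)

  infix 4 _↦_
  _↦_ : Frac r → ℚ → Set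
  F ↦ v = Positive F × evalF F ≡ v

  Evaluates : YSeed r → QSeed r → Set
  Evaluates (B , y) (B' , v) = (∀ i j → B i j ≡ B' i j) × (∀ j → y j ↦ v j)

  ↦-exchange : ∀ {Y Yk V Vk} e₁ e₂ → Y ↦ V → Yk ↦ Vk →
    Y *F (powZF Yk e₁ *F powZF (1F +F Yk) e₂) ↦ V * (powZQ Vk e₁ * powZQ (1ℚ + Vk) e₂)
  ↦-exchange {Y} {Yk} {V} {Vk} e₁ e₂ (Y>0 , Y↦V) (Yk>0 , Yk↦Vk) =
    Positive-*F Y _ Y>0 factors>0 , (begin
      evalF (Y *F (powZF Yk e₁ *F powZF (1F +F Yk) e₂))
        ≡⟨ evalF-*F Y _ (proj₂ Y>0) (proj₂ factors>0) ⟩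
      evalF Y * evalF (powZF Yk e₁ *F powZF (1F +F Yk) e₂)
        ≡⟨ cong (evalF Y *_) (evalF-*F (powZF Yk e₁) _ (proj₂ (Positive-powZF Yk e₁ Yk>0)) (proj₂ (Positive-powZF _ e₂ 1+Yk>0))) ⟩
      evalF Y * (evalF (powZF Yk e₁) * evalF (powZF (1F +F Yk) e₂))
        ≡⟨ cong₂ (λ u v → evalF Y * (u * v)) (evalF-powZF Yk e₁ Yk>0) (evalF-powZF (1F +F Yk) e₂ 1+Yk>0) ⟩
      evalF Y * (powZQ (evalF Yk) e₁ * powZQ (evalF (1F +F Yk)) e₂)
        ≡⟨ cong (λ u → evalF Y * (powZQ (evalF Yk) e₁ * powZQ u e₂))
             (trans (evalF-+F 1F Yk (PositiveDen-constF 1ℤ) (proj₂ Yk>0)) (cong (_+ evalF Yk) evalF-1F)) ⟩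
      evalF Y * (powZQ (evalF Yk) e₁ * powZQ (1ℚ + evalF Yk) e₂)
        ≡⟨ cong₂ (λ u w → u * (powZQ w e₁ * powZQ (1ℚ + w) e₂)) Y↦V Yk↦Vk ⟩
      V * (powZQ Vk e₁ * powZQ (1ℚ + Vk) e₂) ∎)
    where
    open ≡-Reasoning
    1+Yk>0 = Positive-+F 1F Yk Positive-1F Yk>0
    factors>0 = Positive-*F (powZF Yk e₁) _ (Positive-powZF Yk e₁ Yk>0) (Positive-powZF _ e₂ 1+Yk>0)

  Evaluates-μ : ∀ k s q → Evaluates s q → Evaluates (μY k s) (μQ k q)
  Evaluates-μ k (B , y) (B' , v) (B≗B' , y↦v) = μB-cong k B≗B' , values
    where
    values : ∀ j → proj₂ (μY k (B , y)) j ↦ proj₂ (μQ k (B' , v)) j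
    values j with j ≟F k
    ... | true  = Positive-invF (y k) (proj₁ (y↦v k)) ,
                  trans (evalF-invF (y k) (proj₁ (y↦v k))) (cong inv (proj₂ (y↦v k)))
    ... | false rewrite B≗B' k j = ↦-exchange [ B' k j ]₊ (ℤ.- B' k j) (y↦v j) (y↦v k)

  Evaluates-seedAt : ∀ B → (∀ j → 0ℚ < c j) → ∀ w → Evaluates (seedAt B w) (seedQ (B , c) w)
  Evaluates-seedAt B c>0 w = Evaluates-foldl w (rootSeed B) (B , c) root
    where
    Evaluates-foldl : ∀ w s q → Evaluates s q → Evaluates (foldl (λ s k → μY k s) s w) (seedQ q w)
    Evaluates-foldl []      s q s↦q = s↦q
    Evaluates-foldl (k ∷ w) s q s↦q = Evaluates-foldl w (μY k s) (μQ k q) (Evaluates-μ k s q s↦q)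
    root : Evaluates (rootSeed B) (B , c)
    root = (λ i j → refl) , λ j →
      (subst (0ℚ <_) (sym (evalP-varP j c)) (c>0 j) , PositiveDen-constF 1ℤ) ,
      trans (cong₂ (λ u w → u * inv w) (evalP-varP j c) evalℚ-oneP) (trans (cong (c j *_) inv-1) (ℚP.*-identityʳ (c j)))

  yBelt↦seedQ : ∀ B → (∀ j → 0ℚ < c j) → ∀ i m → yBelt B i m ↦ proj₂ (seedQ (B , c) (pathTo i m)) i
  yBelt↦seedQ B c>0 i m = proj₂ (Evaluates-seedAt B c>0 (pathTo i m)) i

-- The Y-seeds of the belt at the frieze point

module _ {r} (A : Mat r) (k : Fin r → ℤ → ℕ) {j l : Fin r} {m : ℤ} where

  YFactor-< : toℕ j ℕ.< toℕ l → YFactor A k j m l ≡ (1 ℕ.+ k l m) ℕ.^ ∣ A l j ∣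
  YFactor-< j<l rewrite <ᵇ-true j<l = refl

  YFactor-> : toℕ l ℕ.< toℕ j → YFactor A k j m l ≡ (1 ℕ.+ k l (m ℤ.+ 1ℤ)) ℕ.^ ∣ A l j ∣
  YFactor-> l<j rewrite <ᵇ-false (ℕP.<-asym l<j) | <ᵇ-true l<j = refl

  YFactor-≮ : ¬ toℕ j ℕ.< toℕ l → ¬ toℕ l ℕ.< toℕ j → YFactor A k j m l ≡ 1
  YFactor-≮ j≮l l≮j rewrite <ᵇ-false j≮l | <ᵇ-false l≮j = refl

-1-n≡-[1+n] : ∀ n → -[1+ 0 ] ℤ.- + n ≡ -[1+ n ]
-1-n≡-[1+n] zero    = refl
-1-n≡-[1+n] (suc n) = refl

module FriezePoint {r : ℕ} (A : Mat r) (A-offdiag : ∀ i j → i ≢ j → A i j ℤ.≤ 0ℤ)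
                   (k : Fin r → ℤ → ℕ) (frieze : IsArithYFrieze A k) where

  open IsArithYFrieze frieze

  K : Fin r → ℤ → ℚ
  K j m = fromℤ (+ k j m)

  K-pos : ∀ j m → 0ℚ < K j m
  K-pos j m = fromℤ-pos (positive j m)

  fac : Fin r → ℤ → Fin r → ℚ
  fac j m l = (1ℚ + K l m) ^ ∣ A l j ∣

  fac-pos : ∀ j m l → 0ℚ < fac j m l
  fac-pos j m l = ^-pos ∣ A l j ∣ (+-pos 0<1 (K-pos l m))

  -- The Y-seed at t(s+1, m), i.e. after the mutations at the Fin indices 0, …, s-1 of round m,
  -- evaluated at the frieze point σ 0 0.
  σ : ℕ → ℤ → Fin r → ℚ
  σ s m j with toℕ j ℕ.<? s
  ... | yes _ = inv (K j m) * window (suc (toℕ j)) s (fac j m)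
  ... | no _  = K j m * inv (window s (toℕ j) (fac j m))

  σ-< : ∀ {s m j} → toℕ j ℕ.< s → σ s m j ≡ inv (K j m) * window (suc (toℕ j)) s (fac j m)
  σ-< {s} {m} {j} j<s with toℕ j ℕ.<? s
  ... | yes _   = refl
  ... | no j≮s = contradiction j<s j≮s

  σ-≮ : ∀ {s m j} → ¬ toℕ j ℕ.< s → σ s m j ≡ K j m * inv (window s (toℕ j) (fac j m))
  σ-≮ {s} {m} {j} j≮s with toℕ j ℕ.<? s
  ... | yes j<s = contradiction j<s j≮s
  ... | no _    = refl

  σ-pos : ∀ s m j → 0ℚ < σ s m j
  σ-pos s m j with toℕ j ℕ.<? s
  ... | yes _ = *-pos (inv-pos (K-pos j m)) (window-pos (suc (toℕ j)) s (fac j m) (fac-pos j m))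
  ... | no _  = *-pos (K-pos j m) (inv-pos (window-pos s (toℕ j) (fac j m) (fac-pos j m)))

  module _ {i : Fin r} {s : ℕ} (i≡s : toℕ i ≡ s) where

    σ-self : ∀ m → σ s m i ≡ K i m
    σ-self m = begin
      σ s m i                                   ≡⟨ σ-≮ (ℕP.<-irrefl i≡s) ⟩
      K i m * inv (window s (toℕ i) (fac i m))  ≡⟨ cong (λ w → K i m * inv w) (window-empty (fac i m) (ℕP.≤-reflexive i≡s)) ⟩
      K i m * inv 1ℚ                            ≡⟨ cong (K i m *_) inv-1 ⟩
      K i m * 1ℚ                                ≡⟨ ℚP.*-identityʳ (K i m) ⟩
      K i m                                     ∎
      where open ≡-Reasoning

    σ-suc-self : ∀ m → σ (suc s) m i ≡ inv (K i m)
    σ-suc-self m = begin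
      σ (suc s) m i
        ≡⟨ σ-< (s≤s (ℕP.≤-reflexive i≡s)) ⟩
      inv (K i m) * window (suc (toℕ i)) (suc s) (fac i m)
        ≡⟨ cong (inv (K i m) *_) (window-empty (fac i m) (s≤s (ℕP.≤-reflexive (sym i≡s)))) ⟩
      inv (K i m) * 1ℚ
        ≡⟨ ℚP.*-identityʳ (inv (K i m)) ⟩
      inv (K i m) ∎
      where open ≡-Reasoning

    σ-suc : ∀ m {j} → j ≢ i → σ (suc s) m j ≡ σ s m j * fac j m i
    σ-suc m {j} j≢i = by-cases (toℕ j ℕ.<? s)
      where
      open ≡-Reasoning
      f = fac j m i
      by-cases : Dec (toℕ j ℕ.< s) → σ (suc s) m j ≡ σ s m j * f
      by-cases (yes j<s) = begin
        σ (suc s) m j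
          ≡⟨ σ-< (ℕP.m<n⇒m<1+n j<s) ⟩
        inv (K j m) * window (suc (toℕ j)) (suc s) (fac j m)
          ≡⟨ cong (inv (K j m) *_) (window-extendʳ (fac j m) i≡s j<s) ⟩
        inv (K j m) * (f * W)
          ≡⟨ solve 3 (λ κ f W → κ :* (f :* W) := (κ :* W) :* f) refl (inv (K j m)) f W ⟩
        (inv (K j m) * W) * f
          ≡⟨ cong (_* f) (σ-< j<s) ⟨
        σ s m j * f ∎
        where W = window (suc (toℕ j)) s (fac j m)
      by-cases (no j≮s) = begin
        σ (suc s) m j
          ≡⟨ σ-≮ {suc s} {m} {j} (λ j<1+s → j≮s (<suc∧≢⇒< j<1+s (toℕ-≢ i≡s j≢i))) ⟩
        K j m * inv W
          ≡⟨ ℚP.*-identityʳ (K j m * inv W) ⟨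
        (K j m * inv W) * 1ℚ
          ≡⟨ cong ((K j m * inv W) *_) (*-inv f (>0⇒≢0 (fac-pos j m i))) ⟨
        (K j m * inv W) * (f * inv f)
          ≡⟨ solve 4 (λ κ w f g → (κ :* w) :* (f :* g) := (κ :* (g :* w)) :* f) refl (K j m) (inv W) f (inv f) ⟩
        (K j m * (inv f * inv W)) * f
          ≡⟨ cong (λ w → (K j m * w) * f) (inv-* f W (>0⇒≢0 (fac-pos j m i)) (>0⇒≢0 (window-pos (suc s) (toℕ j) (fac j m) (fac-pos j m)))) ⟨
        (K j m * inv (f * W)) * f
          ≡⟨ cong (λ w → (K j m * inv w) * f) (window-extendˡ (fac j m) i≡s (≮∧≢⇒> j≮s (toℕ-≢ i≡s j≢i))) ⟨
        (K j m * inv (window s (toℕ j) (fac j m))) * f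
          ≡⟨ cong (_* f) (σ-≮ {s} {m} {j} j≮s) ⟨
        σ s m j * f ∎
        where
        W = window (suc s) (toℕ j) (fac j m)

  YFactor-split : ∀ j m l → fromℤ (+ YFactor A k j m l) ≡
    restrict (suc (toℕ j)) r (fac j m) l * restrict 0 (toℕ j) (fac j (m ℤ.+ 1ℤ)) l
  YFactor-split j m l with toℕ j ℕ.<? toℕ l | toℕ l ℕ.<? toℕ j
  ... | yes j<l | yes l<j = contradiction l<j (ℕP.<-asym j<l)
  ... | yes j<l | no l≮j = begin
    fromℤ (+ YFactor A k j m l)
      ≡⟨ cong (fromℤ ∘ +_) (YFactor-< A k j<l) ⟩
    fromℤ (+ ((1 ℕ.+ k l m) ℕ.^ ∣ A l j ∣))
      ≡⟨ fromℤ-1+^ (k l m) ∣ A l j ∣ ⟩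
    fac j m l
      ≡⟨ restrict-in (fac j m) (within j<l (toℕ<n l)) ⟨
    restrict (suc (toℕ j)) r (fac j m) l
      ≡⟨ ℚP.*-identityʳ _ ⟨
    restrict (suc (toℕ j)) r (fac j m) l * 1ℚ
      ≡⟨ cong (restrict (suc (toℕ j)) r (fac j m) l *_) (restrict-out (fac j (m ℤ.+ 1ℤ)) 0 (toℕ j) (l≮j ∘ InWindow.upper)) ⟨
    restrict (suc (toℕ j)) r (fac j m) l * restrict 0 (toℕ j) (fac j (m ℤ.+ 1ℤ)) l ∎
    where open ≡-Reasoning
  ... | no j≮l | yes l<j = begin
    fromℤ (+ YFactor A k j m l)
      ≡⟨ cong (fromℤ ∘ +_) (YFactor-> A k l<j) ⟩
    fromℤ (+ ((1 ℕ.+ k l (m ℤ.+ 1ℤ)) ℕ.^ ∣ A l j ∣))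
      ≡⟨ fromℤ-1+^ (k l (m ℤ.+ 1ℤ)) ∣ A l j ∣ ⟩
    fac j (m ℤ.+ 1ℤ) l
      ≡⟨ restrict-in (fac j (m ℤ.+ 1ℤ)) (within z≤n l<j) ⟨
    restrict 0 (toℕ j) (fac j (m ℤ.+ 1ℤ)) l
      ≡⟨ ℚP.*-identityˡ _ ⟨
    1ℚ * restrict 0 (toℕ j) (fac j (m ℤ.+ 1ℤ)) l
      ≡⟨ cong (_* restrict 0 (toℕ j) (fac j (m ℤ.+ 1ℤ)) l) (restrict-out (fac j m) (suc (toℕ j)) r (j≮l ∘ InWindow.lower)) ⟨
    restrict (suc (toℕ j)) r (fac j m) l * restrict 0 (toℕ j) (fac j (m ℤ.+ 1ℤ)) l ∎
    where open ≡-Reasoning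
  ... | no j≮l | no l≮j =
    trans (cong (fromℤ ∘ +_) (YFactor-≮ A k j≮l l≮j))
          (sym (cong₂ _*_ (restrict-out (fac j m) (suc (toℕ j)) r (j≮l ∘ InWindow.lower))
                          (restrict-out (fac j (m ℤ.+ 1ℤ)) 0 (toℕ j) (l≮j ∘ InWindow.upper))))

  K-relation : ∀ j m → K j m * K j (m ℤ.+ 1ℤ) ≡
    window (suc (toℕ j)) r (fac j m) * window 0 (toℕ j) (fac j (m ℤ.+ 1ℤ))
  K-relation j m = begin
    K j m * K j (m ℤ.+ 1ℤ)
      ≡⟨ fromℤ-* (+ k j m) (+ k j (m ℤ.+ 1ℤ)) ⟨
    fromℤ (+ k j m ℤ.* + k j (m ℤ.+ 1ℤ))
      ≡⟨ cong fromℤ (ℤP.pos-* (k j m) _) ⟨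
    fromℤ (+ (k j m ℕ.* k j (m ℤ.+ 1ℤ)))
      ≡⟨ cong (fromℤ ∘ +_) (relation j m) ⟩
    fromℤ (+ prodFin (YFactor A k j m))
      ≡⟨ fromℤ-prodFin (YFactor A k j m) ⟩
    product (λ l → fromℤ (+ YFactor A k j m l))
      ≡⟨ product-cong (YFactor-split j m) ⟩
    product (λ l → restrict (suc (toℕ j)) r (fac j m) l * restrict 0 (toℕ j) (fac j (m ℤ.+ 1ℤ)) l)
      ≡⟨ product-distrib-* (restrict (suc (toℕ j)) r (fac j m)) (restrict 0 (toℕ j) (fac j (m ℤ.+ 1ℤ))) ⟩
    window (suc (toℕ j)) r (fac j m) * window 0 (toℕ j) (fac j (m ℤ.+ 1ℤ)) ∎
    where open ≡-Reasoning

  σ-round : ∀ m j → σ r m j ≡ σ 0 (m ℤ.+ 1ℤ) j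
  σ-round m j = begin
    σ r m j                 ≡⟨ σ-< (toℕ<n j) ⟩
    inv (K j m) * W₁        ≡⟨ ℚP.*-comm (inv (K j m)) W₁ ⟩
    W₁ * inv (K j m)        ≡⟨ *-inv-cross W₁ (K j m) (K j (m ℤ.+ 1ℤ)) W₂
                                 (trans (sym (K-relation j m)) (ℚP.*-comm (K j m) (K j (m ℤ.+ 1ℤ))))
                                 (>0⇒≢0 (K-pos j m)) (>0⇒≢0 (window-pos 0 (toℕ j) (fac j (m ℤ.+ 1ℤ)) (fac-pos j (m ℤ.+ 1ℤ)))) ⟩
    K j (m ℤ.+ 1ℤ) * inv W₂ ≡⟨ σ-≮ {0} {m ℤ.+ 1ℤ} {j} (λ ()) ⟨
    σ 0 (m ℤ.+ 1ℤ) j        ∎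
    where
    open ≡-Reasoning
    W₁ = window (suc (toℕ j)) r (fac j m)
    W₂ = window 0 (toℕ j) (fac j (m ℤ.+ 1ℤ))

  BeltSeed : ℕ → ℤ → QSeed r → Set
  BeltSeed s m (B , v) = (∀ j l → B j l ≡ flipB A s j l) × (∀ j → v j ≡ σ s m j)

  module _ {i : Fin r} {s : ℕ} (i≡s : toℕ i ≡ s) {m : ℤ} where

    BeltSeed-μQ : ∀ q → BeltSeed s m q → BeltSeed (suc s) m (μQ i q)
    BeltSeed-μQ (B , v) (B≗ , v≡σ) = (λ j l → trans (μB-cong i B≗ j l) (μB-flipB A A-offdiag i≡s j l)) , values
      where
      vᵢ≡K : v i ≡ K i m
      vᵢ≡K = trans (v≡σ i) (σ-self i≡s m)
      values : ∀ j → proj₂ (μQ i (B , v)) j ≡ σ (suc s) m j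
      values j with j Fin.≟ i
      ... | yes refl = trans (μQ-self i (B , v)) (trans (cong inv vᵢ≡K) (sym (σ-suc-self i≡s m)))
      ... | no j≢i = begin
        proj₂ (μQ i (B , v)) j
          ≡⟨ μQ-other i (B , v) j≢i ⟩
        v j * (powZQ (v i) [ B i j ]₊ * powZQ (1ℚ + v i) (ℤ.- B i j))
          ≡⟨ cong₂ (λ x b → v j * (powZQ x [ b ]₊ * powZQ (1ℚ + x) (ℤ.- b))) vᵢ≡K (trans (B≗ i j) (flipB-row A i≡s j≢i)) ⟩
        v j * (powZQ (K i m) [ A i j ]₊ * powZQ (1ℚ + K i m) (ℤ.- A i j))
          ≡⟨ cong₂ _*_ (v≡σ j) (exchange-nonpos (K i m) (A i j) (A-offdiag i j (j≢i ∘ sym))) ⟩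
        σ s m j * fac j m i
          ≡⟨ σ-suc i≡s m j≢i ⟨
        σ (suc s) m j ∎
        where open ≡-Reasoning

    BeltSeed-μQ-suc : ∀ q → BeltSeed (suc s) m q → BeltSeed s m (μQ i q)
    BeltSeed-μQ-suc (B , v) (B≗ , v≡σ) = (λ j l → trans (μB-cong i B≗ j l) (μB-flipB-suc A A-offdiag i≡s j l)) , values
      where
      vᵢ≡K⁻¹ : v i ≡ inv (K i m)
      vᵢ≡K⁻¹ = trans (v≡σ i) (σ-suc-self i≡s m)
      values : ∀ j → proj₂ (μQ i (B , v)) j ≡ σ s m j
      values j with j Fin.≟ i
      ... | yes refl = trans (μQ-self i (B , v))
                       (trans (cong inv vᵢ≡K⁻¹) (trans (inv-involutive (K i m) (>0⇒≢0 (K-pos i m))) (sym (σ-self i≡s m))))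
      ... | no j≢i = begin
        proj₂ (μQ i (B , v)) j
          ≡⟨ μQ-other i (B , v) j≢i ⟩
        v j * (powZQ (v i) [ B i j ]₊ * powZQ (1ℚ + v i) (ℤ.- B i j))
          ≡⟨ cong₂ (λ x b → v j * (powZQ x [ b ]₊ * powZQ (1ℚ + x) (ℤ.- b))) vᵢ≡K⁻¹ (trans (B≗ i j) (flipB-suc-row A i≡s j≢i)) ⟩
        v j * (powZQ (inv (K i m)) [ ℤ.- A i j ]₊ * powZQ (1ℚ + inv (K i m)) (ℤ.- (ℤ.- A i j)))
          ≡⟨ cong₂ _*_ (trans (v≡σ j) (σ-suc i≡s m j≢i)) (exchange-inv-nonpos (K i m) (A i j) (K-pos i m) (A-offdiag i j (j≢i ∘ sym))) ⟩
        (σ s m j * f) * inv f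
          ≡⟨ ℚP.*-assoc (σ s m j) f (inv f) ⟩
        σ s m j * (f * inv f)
          ≡⟨ cong (σ s m j *_) (*-inv f (>0⇒≢0 (fac-pos j m i))) ⟩
        σ s m j * 1ℚ
          ≡⟨ ℚP.*-identityʳ (σ s m j) ⟩
        σ s m j ∎
        where
        open ≡-Reasoning
        f = fac j m i

  BeltSeed-round : ∀ {m} q → BeltSeed r m q → BeltSeed 0 (m ℤ.+ 1ℤ) q
  BeltSeed-round {m} (B , v) (B≗ , v≡σ) =
    (λ j l → trans (B≗ j l) (trans (flipB-r A j l) (sym (flipB-0 A j l)))) , λ j → trans (v≡σ j) (σ-round m j)

  BeltSeed-unround : ∀ {m} q → BeltSeed 0 (m ℤ.+ 1ℤ) q → BeltSeed r m q
  BeltSeed-unround {m} (B , v) (B≗ , v≡σ) =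
    (λ j l → trans (B≗ j l) (trans (flipB-0 A j l) (sym (flipB-r A j l)))) , λ j → trans (v≡σ j) (sym (σ-round m j))

  BeltSeed-ascending : ∀ {s e m} {L : List (Fin r)} → Ascending s e L → ∀ q → BeltSeed s m q → BeltSeed e m (seedQ q L)
  BeltSeed-ascending []          q bs = bs
  BeltSeed-ascending (i≡s ∷ asc) q bs = BeltSeed-ascending asc (μQ _ q) (BeltSeed-μQ i≡s q bs)

  BeltSeed-descending : ∀ {t u m} {L : List (Fin r)} → Descending t u L → ∀ q → BeltSeed t m q → BeltSeed u m (seedQ q L)
  BeltSeed-descending []           q bs = bs
  BeltSeed-descending (i≡t ∷ desc) q bs = BeltSeed-descending desc (μQ _ q) (BeltSeed-μQ-suc i≡t q bs)

  BeltSeed-forward-rounds : ∀ n {m} q → BeltSeed 0 m q → BeltSeed 0 (m ℤ.+ + n) (seedQ q (concat (replicate n (allFin r))))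
  BeltSeed-forward-rounds zero    {m} q bs = subst (λ m → BeltSeed 0 m q) (sym (ℤP.+-identityʳ m)) bs
  BeltSeed-forward-rounds (suc n) {m} q bs =
    subst₂ (BeltSeed 0) (ℤP.+-assoc m 1ℤ (+ n)) (sym (seedQ-++ q (allFin r) _))
      (BeltSeed-forward-rounds n _ (BeltSeed-round _ (BeltSeed-ascending allFin-ascending q bs)))

  BeltSeed-backward-rounds : ∀ n {m} q → BeltSeed r m q →
    BeltSeed r (m ℤ.- + n) (seedQ q (concat (replicate n (reverse (allFin r)))))
  BeltSeed-backward-rounds zero    {m} q bs = subst (λ m → BeltSeed r m q) (sym (ℤP.+-identityʳ m)) bs
  BeltSeed-backward-rounds (suc n) {m} q bs =
    subst₂ (BeltSeed r) m-1-n≡m-[1+n] (sym (seedQ-++ q (reverse (allFin r)) _))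
      (BeltSeed-backward-rounds n q′ (BeltSeed-unround {m ℤ.- 1ℤ} q′ (subst (λ m → BeltSeed 0 m q′) m≡m-1+1
        (BeltSeed-descending (reverse-ascending allFin-ascending) q bs))))
    where
    q′ = seedQ q (reverse (allFin r))
    m≡m-1+1 : m ≡ (m ℤ.- 1ℤ) ℤ.+ 1ℤ
    m≡m-1+1 = sym (trans (ℤP.+-assoc m -[1+ 0 ] 1ℤ) (ℤP.+-identityʳ m))
    m-1-n≡m-[1+n] : (m ℤ.- 1ℤ) ℤ.- + n ≡ m ℤ.- + suc n
    m-1-n≡m-[1+n] = trans (ℤP.+-assoc m -[1+ 0 ] (ℤ.- + n)) (cong (λ z → m ℤ.+ z) (-1-n≡-[1+n] n))

  initial : BeltSeed 0 0ℤ (BA A , σ 0 0ℤ)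
  initial = (λ j l → sym (flipB-0 A j l)) , λ j → refl

  seedQ-pathTo : ∀ i m → proj₂ (seedQ (BA A , σ 0 0ℤ) (pathTo i m)) i ≡ K i m
  seedQ-pathTo i (+ n) = begin
    proj₂ (seedQ q₀ (rounds ++ partial)) i    ≡⟨ cong (λ q → proj₂ q i) (seedQ-++ q₀ rounds partial) ⟩
    proj₂ (seedQ (seedQ q₀ rounds) partial) i ≡⟨ proj₂ (BeltSeed-ascending partial-ascending (seedQ q₀ rounds) after-rounds) i ⟩
    σ (toℕ i) (+ n) i                         ≡⟨ σ-self refl (+ n) ⟩
    K i (+ n)                                 ∎
    where
    open ≡-Reasoning
    q₀ = (BA A , σ 0 0ℤ)
    rounds = concat (replicate n (allFin r))
    partial = take (toℕ i) (allFin r)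
    partial-ascending : Ascending 0 (toℕ i) partial
    partial-ascending = take-ascending allFin-ascending (toℕ i) (ℕP.<⇒≤ (toℕ<n i))
    after-rounds : BeltSeed 0 (+ n) (seedQ q₀ rounds)
    after-rounds = subst (λ m → BeltSeed 0 m (seedQ q₀ rounds)) (ℤP.+-identityˡ (+ n))
                         (BeltSeed-forward-rounds n q₀ initial)
  seedQ-pathTo i -[1+ n ] = begin
    proj₂ (seedQ q₀ (rounds ++ partial)) i    ≡⟨ cong (λ q → proj₂ q i) (seedQ-++ q₀ rounds partial) ⟩
    proj₂ (seedQ (seedQ q₀ rounds) partial) i ≡⟨ proj₂ (BeltSeed-descending partial-descending (seedQ q₀ rounds) after-rounds) i ⟩
    σ (toℕ i) -[1+ n ] i                      ≡⟨ σ-self refl -[1+ n ] ⟩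
    K i -[1+ n ]                              ∎
    where
    open ≡-Reasoning
    q₀ = (BA A , σ 0 0ℤ)
    rounds = concat (replicate n (reverse (allFin r)))
    partial = take (r ℕ.∸ toℕ i) (reverse (allFin r))
    partial-descending : Descending r (toℕ i) partial
    partial-descending = subst (λ u → Descending r u partial) (ℕP.m∸[m∸n]≡n (ℕP.<⇒≤ (toℕ<n i)))
      (take-descending (reverse-ascending allFin-ascending) (r ℕ.∸ toℕ i) (ℕP.m∸n≤m r (toℕ i)))
    after-rounds : BeltSeed r -[1+ n ] (seedQ q₀ rounds)
    after-rounds = subst (λ m → BeltSeed r m (seedQ q₀ rounds)) (-1-n≡-[1+n] n)
                         (BeltSeed-backward-rounds n q₀ (BeltSeed-unround { -[1+ 0 ] } q₀ initial))

-- The specialisation homomorphism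

additive⇒id : (H : ℤ → ℤ) → (∀ a b → H (a ℤ.+ b) ≡ H a ℤ.+ H b) → H 1ℤ ≡ 1ℤ → ∀ z → H z ≡ z
additive⇒id H H-+ H1≡1 = H≗id
  where
  H0≡0 : H 0ℤ ≡ 0ℤ
  H0≡0 = identityʳ-unique (H 0ℤ) (H 0ℤ) (sym (H-+ 0ℤ 0ℤ))
  H+≗id : ∀ n → H (+ n) ≡ + n
  H+≗id zero    = H0≡0
  H+≗id (suc n) = trans (H-+ 1ℤ (+ n)) (cong₂ ℤ._+_ H1≡1 (H+≗id n))
  H≗id : ∀ z → H z ≡ z
  H≗id (+ n)    = H+≗id n
  H≗id -[1+ n ] = inverseˡ-unique (H -[1+ n ]) (+ suc n) (begin
    H -[1+ n ] ℤ.+ + suc n          ≡⟨ cong (λ h → H -[1+ n ] ℤ.+ h) (H+≗id (suc n)) ⟨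
    H -[1+ n ] ℤ.+ H (+ suc n)      ≡⟨ H-+ -[1+ n ] (+ suc n) ⟨
    H (-[1+ n ] ℤ.+ + suc n)        ≡⟨ cong H (ℤP.+-inverseˡ (+ suc n)) ⟩
    H 0ℤ                            ≡⟨ H0≡0 ⟩
    0ℤ                              ∎)
    where open ≡-Reasoning

evalExpr : ∀ {r} → (Fin r → ℤ → ℕ) → Expr r → ℤ
evalExpr k (gen i m) = + k i m
evalExpr k (cst z)   = z
evalExpr k (e ⊕ f)   = evalExpr k e ℤ.+ evalExpr k f
evalExpr k (e ⊗ f)   = evalExpr k e ℤ.* evalExpr k f

module Specialisation {r : ℕ} (B : Mat r) (k : Fin r → ℤ → ℕ) (c : Fin r → ℚ)
  (y↦k : ∀ i m → AtPoint.PositiveDen c (yBelt B i m) × AtPoint.evalF c (yBelt B i m) ≡ fromℤ (+ k i m)) where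

  open AtPoint c

  evalE-at-c : ∀ e → PositiveDen (evalE B e) × evalF (evalE B e) ≡ fromℤ (evalExpr k e)
  evalE-at-c (gen i m) = y↦k i m
  evalE-at-c (cst z)   = PositiveDen-constF z , evalF-constF z
  evalE-at-c (e ⊕ f)   =
    let dₑ>0 , e↦ = evalE-at-c e ; d_f>0 , f↦ = evalE-at-c f in
    PositiveDen-+F (evalE B e) (evalE B f) dₑ>0 d_f>0 ,
    trans (evalF-+F (evalE B e) (evalE B f) dₑ>0 d_f>0)
          (trans (cong₂ _+_ e↦ f↦) (sym (fromℤ-+ (evalExpr k e) (evalExpr k f))))
  evalE-at-c (e ⊗ f)   =
    let dₑ>0 , e↦ = evalE-at-c e ; d_f>0 , f↦ = evalE-at-c f in
    PositiveDen-*F (evalE B e) (evalE B f) dₑ>0 d_f>0 ,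
    trans (evalF-*F (evalE B e) (evalE B f) dₑ>0 d_f>0)
          (trans (cong₂ _*_ e↦ f↦) (sym (fromℤ-* (evalExpr k e) (evalExpr k f))))

  evalExpr-cong : ∀ e e' → evalE B e ≈F evalE B e' → evalExpr k e ≡ evalExpr k e'
  evalExpr-cong e e' e≈e' = fromℤ-injective (begin
    fromℤ (evalExpr k e)   ≡⟨ proj₂ (evalE-at-c e) ⟨
    evalF (evalE B e)      ≡⟨ evalF-cong (evalE B e) (evalE B e') e≈e' (proj₁ (evalE-at-c e)) (proj₁ (evalE-at-c e')) ⟩
    evalF (evalE B e')     ≡⟨ proj₂ (evalE-at-c e') ⟩
    fromℤ (evalExpr k e')  ∎)
    where open ≡-Reasoning

  ≈F-expr : ∀ e F (x : Belt B) → ¬ IsZeroP (den F) → evalE B e ≈F F → F ≈F val x → evalE B e ≈F evalE B (expr x)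
  ≈F-expr e F x F≢0 e≈F F≈x =
    ≈F-trans (evalE B e) (val x) (evalE B (expr x)) (den≢0 x)
      (≈F-trans (evalE B e) F (val x) F≢0 e≈F F≈x) (≈F-sym (evalE B (expr x)) (val x) (expr≈ x))

  h : Belt B → ℤ
  h x = evalExpr k (expr x)

  h-isRingHom : IsRingHom h
  h-isRingHom = record
    { resp = λ x y x≈y → evalExpr-cong (expr x) (expr y) (≈F-expr (expr x) (val x) y (den≢0 x) (expr≈ x) x≈y)
    ; one  = λ x x≈1 → evalExpr-cong (expr x) (cst 1ℤ) (≈F-trans (evalE B (expr x)) (val x) 1F (den≢0 x) (expr≈ x) x≈1)
    ; add  = λ x y z x+y≈z → sym (evalExpr-cong (expr x ⊕ expr y) (expr z)
               (≈F-expr (expr x ⊕ expr y) (val x +F val y) z (mulP-≢0 (den (val x)) (den (val y)) (den≢0 x) (den≢0 y))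
                 (+F-cong _ (val x) _ (val y) (expr≈ x) (expr≈ y)) x+y≈z))
    ; mul  = λ x y z xy≈z → sym (evalExpr-cong (expr x ⊗ expr y) (expr z)
               (≈F-expr (expr x ⊗ expr y) (val x *F val y) z (mulP-≢0 (den (val x)) (den (val y)) (den≢0 x) (den≢0 y))
                 (*F-cong _ (val x) _ (val y) (expr≈ x) (expr≈ y)) xy≈z))
    }

  h-matches : Matches h k
  h-matches i m x x≈y = evalExpr-cong (expr x) (gen i m) (≈F-trans (evalE B (expr x)) (val x) (yBelt B i m) (den≢0 x) (expr≈ x) x≈y)

  beltOf : Expr r → Belt B
  beltOf e = belt (evalE B e) (PositiveDen⇒den≢0 (evalE B e) (proj₁ (evalE-at-c e))) e (≈F-refl (evalE B e))

  module _ (h' : Belt B → ℤ) (h'-isRingHom : IsRingHom h') (h'-matches : Matches h' k) where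

    open IsRingHom h'-isRingHom renaming (resp to h'-resp; one to h'-one; add to h'-add; mul to h'-mul)

    h'-constants : ∀ z → h' (beltOf (cst z)) ≡ z
    h'-constants = additive⇒id (λ z → h' (beltOf (cst z)))
      (λ a b → h'-add (beltOf (cst a)) (beltOf (cst b)) (beltOf (cst (a ℤ.+ b))) (constF-+F a b))
      (h'-one (beltOf (cst 1ℤ)) (≈F-refl 1F))

    h'-beltOf : ∀ e → h' (beltOf e) ≡ evalExpr k e
    h'-beltOf (gen i m) = h'-matches i m (beltOf (gen i m)) (≈F-refl _)
    h'-beltOf (cst z)   = h'-constants z
    h'-beltOf (e ⊕ f)   = trans (h'-add (beltOf e) (beltOf f) (beltOf (e ⊕ f)) (≈F-refl _)) (cong₂ ℤ._+_ (h'-beltOf e) (h'-beltOf f))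
    h'-beltOf (e ⊗ f)   = trans (h'-mul (beltOf e) (beltOf f) (beltOf (e ⊗ f)) (≈F-refl _)) (cong₂ ℤ._*_ (h'-beltOf e) (h'-beltOf f))

    h-unique : ∀ x → h' x ≡ h x
    h-unique x = trans (h'-resp x (beltOf (expr x)) (≈F-sym _ _ (expr≈ x))) (h'-beltOf (expr x))

proposition3p7 : (r : ℕ) (A : Mat r) → IsSymGCM A →
    (k : Fin r → ℤ → ℕ) → IsArithYFrieze A k →
    Σ (Belt (BA A) → ℤ) (λ h → IsRingHom h × Matches h k ×
      ((h' : Belt (BA A) → ℤ) → IsRingHom h' → Matches h' k → ∀ x → h' x ≡ h x))
proposition3p7 r A gcm k frieze = h , h-isRingHom , h-matches , h-unique
  where
  open FriezePoint A (IsSymGCM.offdiag gcm) k frieze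
  open AtPoint (σ 0 0ℤ) using (PositiveDen; evalF; yBelt↦seedQ)
  y↦k : ∀ i m → PositiveDen (yBelt (BA A) i m) × evalF (yBelt (BA A) i m) ≡ fromℤ (+ k i m)
  y↦k i m =
    let (_ , den>0) , y↦ = yBelt↦seedQ (BA A) (σ-pos 0 0ℤ) i m in
    den>0 , trans y↦ (seedQ-pathTo i m)
  open Specialisation (BA A) k (σ 0 0ℤ) y↦k
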